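{- Let $p=(231,\{1\},\emptyset)$ and $r=(132,\emptyset,\{2\})$. Then the ordinary generating function $\sum_{n\ge0}|\mathrm{Av}_n(p,r)|\,x^n$ equals \[1+\sum_{n\ge 0}x^{n+1}L_n(1+x),\qquad\text{where } L_n(q)=\sum_{m=0}^{n}{n\brack m}_q .\]
   Context: For $n\ge 0$, $\mathcal{S}_n$ is the set of permutations of $[n]=\{1,\dots,n\}$, written as words $\pi=\pi(1)\pi(2)\cdots\pi(n)$. Two words of distinct integers of the same length are order-isomorphic if their entries appear in the same relative order. A pattern of length 3 is a triple $(\sigma,X,Y)$ with $\sigma\in\mathcal{S}_3$ and $X,Y\subseteq\{1,2\}$. A permutation $\pi\in\mathcal{S}_n$ contains $(\sigma,X,Y)$ if there are indices $i_1<i_2<i_3$ such that $\pi(i_1)\pi(i_2)\pi(i_3)$ is order-isomorphic to $\sigma$, $i_{x+1}=i_x+1$ for every $x\in X$, and $j_{y+1}=j_y+1$ for every $y\in Y$, where $j_1<j_2<j_3$ are the three values $\pi(i_1),\pi(i_2),\pi(i_3)$ listed in increasing order; otherwise $\pi$ avoids it. For patterns $P_1,\dots,P_m$, $\mathrm{Av}_n(P_1,\dots,P_m)$ is the set of $\pi\in\mathcal{S}_n$ avoiding every $P_i$. ${n\brack m}_q=\prod_{i=1}^{m}\frac{1-q^{n-m+i}}{1-q^{i}}$ is the Gaussian ($q$-)binomial coefficient, a polynomial in $q$ (equivalently, the generating polynomial, by area under the path, of lattice paths from $(0,0)$ with $m$ unit east steps and $n-m$ unit north steps). -}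

module Defs where

open import Data.Nat using (ℕ; zero; suc; _+_; _*_; _∸_)
open import Data.Bool using (Bool; true; false; if_then_else_)
import Data.Fin
open import Data.Fin using (Fin; toℕ; inject₁) renaming (_<_ to _<ᶠ_)
open import Data.Fin.Patterns using (0F; 1F; 2F)
open import Data.Vec using (Vec; lookup; []; _∷_)
open import Data.List using (List; []; _∷_; map; concatMap; length; filter; replicate; _++_)
open import Data.List.Relation.Unary.Unique.Propositional using (Unique)
open import Data.List.Membership.Propositional using (_∈_)
open import Data.Product using (Σ; _×_; ∃-syntax)
open import Function.Bundles using (_⇔_)
open import Relation.Binary.PropositionalEquality using (_≡_)
open import Relation.Nullary using (¬_)
import Data.Nat as ℕ
import Data.List

-- Permutations of [n], as words.  We use the alphabet Fin n = {0,…,n-1}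
-- in place of {1,…,n}; only relative order and "differ by one" matter.

IsPerm : {n : ℕ} → Vec (Fin n) n → Set
IsPerm {n} π = (i j : Fin n) → lookup π i ≡ lookup π j → i ≡ j

-- Patterns of length 3: (σ, X, Y), σ ∈ S₃, X, Y ⊆ {1,2}.
-- σ is written 0-based as a function Fin 3 → Fin 3 (a bijection);
-- a subset of {1,2} is a characteristic function Fin 2 → Bool
-- (0F stands for 1, 1F stands for 2).

record Pattern : Set where
  field
    σ     : Fin 3 → Fin 3
    σ-inj : (a b : Fin 3) → σ a ≡ σ b → a ≡ b
    X     : Fin 2 → Bool
    Y     : Fin 2 → Bool

Contains : {n : ℕ} → Vec (Fin n) n → Pattern → Set
Contains {n} π P =
  Σ (Fin n) λ i₁ → Σ (Fin n) λ i₂ → Σ (Fin n) λ i₃ →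
  let ι : Fin 3 → Fin n
      ι = λ { 0F → i₁ ; 1F → i₂ ; 2F → i₃ }
      v : Fin 3 → ℕ
      v a = toℕ (lookup π (ι a))
  in (i₁ <ᶠ i₂) × (i₂ <ᶠ i₃)
     × ((a b : Fin 3) → (v a ℕ.< v b) ⇔ (σ a <ᶠ σ b))
     × ((x : Fin 2) → X x ≡ true → toℕ (ι (Data.Fin.suc x)) ≡ suc (toℕ (ι (inject₁ x))))
     -- j_{y+1} = j_y + 1 for y ∈ Y, where j_k is the k-th smallest of the
     -- three values, i.e. j_k = π(i_a) with σ(a) = k
     × ((y : Fin 2) → Y y ≡ true → (a b : Fin 3) →
          σ a ≡ inject₁ y → σ b ≡ Data.Fin.suc y → v b ≡ suc (v a))
  where open Pattern P

Avoids : {n : ℕ} → Vec (Fin n) n → Pattern → Set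
Avoids π P = ¬ Contains π P

HasCard : {V : Set} → (V → Set) → ℕ → Set
HasCard {V} A N = Σ (List V) λ L → Unique L × ((v : V) → (v ∈ L) ⇔ A v) × length L ≡ N

AvCard₂ : (n : ℕ) → Pattern → Pattern → ℕ → Set
AvCard₂ n P₁ P₂ N = HasCard (λ (π : Vec (Fin n) n) → IsPerm π × Avoids π P₁ × Avoids π P₂) N

σ231 : Fin 3 → Fin 3
σ231 0F = 1F
σ231 1F = 2F
σ231 2F = 0F

σ132 : Fin 3 → Fin 3
σ132 0F = 0F
σ132 1F = 2F
σ132 2F = 1F

open import Relation.Binary.PropositionalEquality using (refl)

σ231-inj : (a b : Fin 3) → σ231 a ≡ σ231 b → a ≡ b
σ231-inj 0F 0F _ = refl
σ231-inj 1F 1F _ = refl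
σ231-inj 2F 2F _ = refl
σ231-inj 0F 1F ()
σ231-inj 0F 2F ()
σ231-inj 1F 0F ()
σ231-inj 1F 2F ()
σ231-inj 2F 0F ()
σ231-inj 2F 1F ()

σ132-inj : (a b : Fin 3) → σ132 a ≡ σ132 b → a ≡ b
σ132-inj 0F 0F _ = refl
σ132-inj 1F 1F _ = refl
σ132-inj 2F 2F _ = refl
σ132-inj 0F 1F ()
σ132-inj 0F 2F ()
σ132-inj 1F 0F ()
σ132-inj 1F 2F ()
σ132-inj 2F 0F ()
σ132-inj 2F 1F ()

only1 : Fin 2 → Bool
only1 0F = true
only1 1F = false

only2 : Fin 2 → Bool
only2 0F = false
only2 1F = true

none : Fin 2 → Bool
none _ = false

patP : Pattern
patP = record { σ = σ231 ; σ-inj = σ231-inj ; X = only1 ; Y = none }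

patR : Pattern
patR = record { σ = σ132 ; σ-inj = σ132-inj ; X = none ; Y = only2 }

-- Polynomials with natural-number coefficients, as coefficient lists
-- (constant term first).

Poly : Set
Poly = List ℕ

coeff : Poly → ℕ → ℕ
coeff []       _       = 0
coeff (c ∷ _)  zero    = c
coeff (_ ∷ cs) (suc k) = coeff cs k

_⊕_ : Poly → Poly → Poly
[]       ⊕ q        = q
(a ∷ p)  ⊕ []       = a ∷ p
(a ∷ p)  ⊕ (b ∷ q)  = (a + b) ∷ (p ⊕ q)

scale : ℕ → Poly → Poly
scale c = map (c *_)

_⊗_ : Poly → Poly → Poly
[]      ⊗ q = []
(a ∷ p) ⊗ q = scale a q ⊕ (0 ∷ (p ⊗ q))

monomial : ℕ → Poly
monomial k = replicate k 0 ++ (1 ∷ [])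

shift : ℕ → Poly → Poly
shift k p = replicate k 0 ++ p

polySum : List Poly → Poly
polySum []       = []
polySum (p ∷ ps) = p ⊕ polySum ps

compose : Poly → Poly → Poly
compose []      q = []
compose (c ∷ p) q = (c ∷ []) ⊕ (q ⊗ compose p q)

onePlusX : Poly
onePlusX = 1 ∷ 1 ∷ []

-- Gaussian binomial coefficients as area generating polynomials of
-- lattice paths from (0,0) with m east steps and n - m north steps.
-- A path is a word in {E = true, N = false}.

words : ℕ → List (List Bool)
words zero    = [] ∷ []
words (suc k) = concatMap (λ w → (true ∷ w) ∷ (false ∷ w) ∷ []) (words k)

eastCount : List Bool → ℕ
eastCount []          = 0
eastCount (true ∷ w)  = suc (eastCount w)
eastCount (false ∷ w) = eastCount w

areaFrom : ℕ → List Bool → ℕ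
areaFrom h []          = 0
areaFrom h (true ∷ w)  = h + areaFrom h w
areaFrom h (false ∷ w) = areaFrom (suc h) w

area : List Bool → ℕ
area = areaFrom 0

paths : ℕ → ℕ → List (List Bool)
paths n m = filter (λ w → eastCount w ℕ.≟ m) (words n)

gauss : ℕ → ℕ → Poly
gauss n m = polySum (map (λ w → monomial (area w)) (paths n m))

upTo′ : ℕ → List ℕ
upTo′ n = Data.List.upTo (suc n)

Lpoly : ℕ → Poly
Lpoly n = polySum (map (gauss n) (upTo′ n))

-- Partial sum 1 + Σ_{k=0}^{N} x^{k+1} L_k(1+x).  Since the term for k
-- has lowest degree k+1, its x^n-coefficient agrees with that of the full
-- series whenever N ≥ n.
rhsPartial : ℕ → Poly
rhsPartial N = (1 ∷ []) ⊕ polySum (map (λ k → shift (suc k) (compose (Lpoly k) onePlusX)) (upTo′ N))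

rhsCoeff : ℕ → ℕ
rhsCoeff n = coeff (rhsPartial n) n

-- Avoiders of p and r form a generating tree: deleting the maximum n of an avoider of length n + 1
-- leaves an avoider, and inserting n into an avoider σ keeps it an avoider exactly at the active
-- sites, namely the front of σ and the gap after each right-to-left minimum of σ lying at or after
-- the maximum of σ.  Labelling σ by (h, c) when σ has h + 1 right-to-left minima, c + 1 of them at
-- or after its maximum, the children of a node (h, c) are labelled (h, h), (h + 1, 0) and (h, c′)
-- for c′ < c.  The number of nodes len levels below (h, c) is
-- Σ_{k + d = len} Σ_w binom(c + area_h(w), d), w ranging over the lattice paths of length k and
-- area_h(w) being the area under w started at height h: both sides obey the recursion of the tree,
-- which in c is Pascal's rule.  For (h, c) = (0, 0) this is the coefficient of x^(len+1) in
-- Σ_k x^(k+1) L_k(1 + x), because (1 + x)^a contributes binom(a, d) to x^d.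
module Submission where

open import Data.Bool using (Bool; true; false; if_then_else_; T; _∧_)
open import Data.Bool.Properties using (T-∧)
open import Data.Empty using (⊥; ⊥-elim)
open import Data.Fin using (Fin; toℕ; fromℕ<; punchOut) renaming (_<_ to _<ᶠ_; zero to fzero; suc to fsuc)
open import Data.Fin.Patterns using (0F; 1F; 2F)
import Data.Fin.Properties as Fin
open import Data.List
  using (List; []; _∷_; map; length; filter; filterᵇ; concatMap; _++_; applyUpTo; upTo; take; drop; null)
open import Data.List.Properties using (take++drop≡id; length-map)
open import Data.List.Membership.Propositional using (_∈_; _∉_; find; lose)
open import Data.List.Membership.Propositional.Properties
  using ( ∈-map⁺; ∈-map⁻; ∈-++⁺ʳ; ∈-++⁻; ∈-map∘filter⁻; ∈-map∘filter⁺; ∈-filter⁻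
        ; ∈-upTo⁺; ∈-upTo⁻; ∈-concatMap⁺; ∈-concatMap⁻)
open import Data.List.Relation.Binary.Disjoint.Propositional using (Disjoint)
open import Data.List.Relation.Unary.All using (All; []; _∷_; all?)
import Data.List.Relation.Unary.All as All
import Data.List.Relation.Unary.All.Properties as All
open import Data.List.Relation.Unary.AllPairs using (AllPairs; []; _∷_)
import Data.List.Relation.Unary.AllPairs.Properties as AllPairs
open import Data.List.Relation.Unary.Any using (here; there)
open import Data.List.Relation.Unary.Unique.Propositional using (Unique)
import Data.List.Relation.Unary.Unique.Propositional.Properties as Unique
open import Data.Nat
  using (ℕ; zero; suc; _+_; _*_; _∸_; pred; _<_; _≤_; z≤n; s≤s; z<s; s<s; s≤s⁻¹; s<s⁻¹
        ; _<ᵇ_; _<?_; _≟_)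
open import Data.Nat.Combinatorics using (_C_; nCk+nC[k+1]≡[n+1]C[k+1]; k>n⇒nCk≡0)
open import Data.Nat.Properties
open import Algebra.Properties.CommutativeSemigroup +-commutativeSemigroup using (interchange)
open import Data.Product using (Σ; _×_; _,_; proj₁; proj₂)
open import Data.Sum using (_⊎_; inj₁; inj₂)
import Data.Sum as Sum
open import Data.Unit using (⊤; tt)
open import Data.Vec using (Vec; []; _∷_; lookup; tabulate)
import Data.Vec.Properties as Vec
open import Function using (_∘_; id)
open import Function.Bundles using (_⇔_; mk⇔; Equivalence)
open import Relation.Binary.Definitions using (tri<; tri≈; tri>)
open import Relation.Binary.PropositionalEquality
open import Relation.Nullary using (¬_; yes; no)
open import Relation.Nullary.Decidable using (T?; does; dec-false; does-⇔)
open import Relation.Unary using (Decidable)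

open import Defs

∑ : {A : Set} → List A → (A → ℕ) → ℕ
∑ []       f = 0
∑ (x ∷ xs) f = f x + ∑ xs f

∑< : ℕ → (ℕ → ℕ) → ℕ
∑< zero    f = 0
∑< (suc N) f = f 0 + ∑< N (f ∘ suc)

-- ∑antidiagonal n f = Σ_{k + d = n} f k d
∑antidiagonal : ℕ → (ℕ → ℕ → ℕ) → ℕ
∑antidiagonal zero    f = f 0 0
∑antidiagonal (suc n) f = f 0 (suc n) + ∑antidiagonal n (λ k → f (suc k))

∑-cong-∈ : {A : Set} (xs : List A) {f g : A → ℕ} → (∀ x → x ∈ xs → f x ≡ g x) → ∑ xs f ≡ ∑ xs g
∑-cong-∈ []       e = refl
∑-cong-∈ (x ∷ xs) e = cong₂ _+_ (e x (here refl)) (∑-cong-∈ xs (λ y → e y ∘ there))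

∑-cong : {A : Set} (xs : List A) {f g : A → ℕ} → (∀ x → f x ≡ g x) → ∑ xs f ≡ ∑ xs g
∑-cong xs e = ∑-cong-∈ xs (λ x _ → e x)

∑-+ : {A : Set} (xs : List A) (f g : A → ℕ) → ∑ xs (λ x → f x + g x) ≡ ∑ xs f + ∑ xs g
∑-+ []       f g = refl
∑-+ (x ∷ xs) f g = trans (cong (f x + g x +_) (∑-+ xs f g)) (interchange (f x) (g x) _ _)

∑-map : {A B : Set} (xs : List A) (f : A → B) (g : B → ℕ) → ∑ (map f xs) g ≡ ∑ xs (g ∘ f)
∑-map []       f g = refl
∑-map (x ∷ xs) f g = cong (g (f x) +_) (∑-map xs f g)

∑-++ : {A : Set} (xs ys : List A) (g : A → ℕ) → ∑ (xs ++ ys) g ≡ ∑ xs g + ∑ ys g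
∑-++ []       ys g = refl
∑-++ (x ∷ xs) ys g = trans (cong (g x +_) (∑-++ xs ys g)) (sym (+-assoc (g x) _ _))

∑-concatMap : {A B : Set} (f : A → List B) (xs : List A) (g : B → ℕ) →
              ∑ (concatMap f xs) g ≡ ∑ xs (λ x → ∑ (f x) g)
∑-concatMap f []       g = refl
∑-concatMap f (x ∷ xs) g = trans (∑-++ (f x) _ g) (cong (∑ (f x) g +_) (∑-concatMap f xs g))

∑-filter : {A : Set} {P : A → Set} (P? : Decidable P) (xs : List A) (g : A → ℕ) →
           ∑ (filter P? xs) g ≡ ∑ xs (λ x → if does (P? x) then g x else 0)
∑-filter P? []       g = refl
∑-filter P? (x ∷ xs) g with does (P? x)
... | true  = cong (g x +_) (∑-filter P? xs g)
... | false = ∑-filter P? xs g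

length≡∑1 : {A : Set} (xs : List A) → length xs ≡ ∑ xs (λ _ → 1)
length≡∑1 []       = refl
length≡∑1 (x ∷ xs) = cong suc (length≡∑1 xs)

∑<-cong-< : (N : ℕ) {f g : ℕ → ℕ} → (∀ x → x < N → f x ≡ g x) → ∑< N f ≡ ∑< N g
∑<-cong-< zero    e = refl
∑<-cong-< (suc N) e = cong₂ _+_ (e 0 z<s) (∑<-cong-< N (λ x → e (suc x) ∘ s<s))

∑<-cong : (N : ℕ) {f g : ℕ → ℕ} → (∀ x → f x ≡ g x) → ∑< N f ≡ ∑< N g
∑<-cong N e = ∑<-cong-< N (λ x _ → e x)

∑<-zero : (N : ℕ) → ∑< N (λ _ → 0) ≡ 0
∑<-zero zero    = refl
∑<-zero (suc N) = ∑<-zero N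

∑<-+ : (N : ℕ) (f g : ℕ → ℕ) → ∑< N (λ m → f m + g m) ≡ ∑< N f + ∑< N g
∑<-+ zero    f g = refl
∑<-+ (suc N) f g = trans (cong (f 0 + g 0 +_) (∑<-+ N (f ∘ suc) (g ∘ suc))) (interchange (f 0) (g 0) _ _)

∑<-suc : (N : ℕ) (f : ℕ → ℕ) → ∑< (suc N) f ≡ ∑< N f + f N
∑<-suc zero    f = +-comm (f 0) 0
∑<-suc (suc N) f = trans (cong (f 0 +_) (∑<-suc N (f ∘ suc))) (sym (+-assoc (f 0) _ _))

∑<-∑-comm : {A : Set} (N : ℕ) (xs : List A) (f : ℕ → A → ℕ) →
            ∑< N (λ m → ∑ xs (f m)) ≡ ∑ xs (λ x → ∑< N (λ m → f m x))
∑<-∑-comm N []       f = ∑<-zero N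
∑<-∑-comm N (x ∷ xs) f = trans (∑<-+ N (λ m → f m x) _) (cong (∑< N (λ m → f m x) +_) (∑<-∑-comm N xs f))

∑<-indicator : ∀ N e a → e < N → ∑< N (λ m → if does (e ≟ m) then a else 0) ≡ a
∑<-indicator (suc N) zero    a _         = trans (cong (a +_) (∑<-zero N)) (+-identityʳ a)
∑<-indicator (suc N) (suc e) a (s<s e<N) = ∑<-indicator N e a e<N

∑<-fibres : {A : Set} (ec : A → ℕ) (N : ℕ) (xs : List A) (g : A → ℕ) → All (λ x → ec x < N) xs →
            ∑< N (λ m → ∑ (filter (λ x → ec x ≟ m) xs) g) ≡ ∑ xs g
∑<-fibres ec N xs g bounded = begin
  ∑< N (λ m → ∑ (filter (λ x → ec x ≟ m) xs) g)
    ≡⟨ ∑<-cong N (λ m → ∑-filter (λ x → ec x ≟ m) xs g) ⟩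
  ∑< N (λ m → ∑ xs (λ x → if does (ec x ≟ m) then g x else 0))
    ≡⟨ ∑<-∑-comm N xs _ ⟩
  ∑ xs (λ x → ∑< N (λ m → if does (ec x ≟ m) then g x else 0))
    ≡⟨ ∑-cong-∈ xs (λ x x∈ → ∑<-indicator N (ec x) (g x) (All.lookup bounded x∈)) ⟩
  ∑ xs g ∎
  where open ≡-Reasoning

∑-applyUpTo : (f : ℕ → ℕ) (N : ℕ) (g : ℕ → ℕ) → ∑ (applyUpTo f N) g ≡ ∑< N (g ∘ f)
∑-applyUpTo f zero    g = refl
∑-applyUpTo f (suc N) g = cong (g (f 0) +_) (∑-applyUpTo (f ∘ suc) N g)

∑-upTo : (N : ℕ) (g : ℕ → ℕ) → ∑ (upTo N) g ≡ ∑< N g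
∑-upTo = ∑-applyUpTo id

∑antidiagonal-cong : (n : ℕ) {f g : ℕ → ℕ → ℕ} → (∀ k d → f k d ≡ g k d) →
                     ∑antidiagonal n f ≡ ∑antidiagonal n g
∑antidiagonal-cong zero    e = e 0 0
∑antidiagonal-cong (suc n) e = cong₂ _+_ (e 0 (suc n)) (∑antidiagonal-cong n (e ∘ suc))

∑antidiagonal-+ : (n : ℕ) (f g : ℕ → ℕ → ℕ) →
                  ∑antidiagonal n (λ k d → f k d + g k d) ≡ ∑antidiagonal n f + ∑antidiagonal n g
∑antidiagonal-+ zero    f g = refl
∑antidiagonal-+ (suc n) f g =
  trans (cong (f 0 (suc n) + g 0 (suc n) +_) (∑antidiagonal-+ n (f ∘ suc) (g ∘ suc)))
        (interchange (f 0 (suc n)) (g 0 (suc n)) _ _)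

∑antidiagonal-split : (n : ℕ) (f g f′ : ℕ → ℕ → ℕ) →
  (∀ k d → g k (suc d) ≡ f k (suc d) + f′ k d) → (∀ k → g k 0 ≡ f k 0) →
  ∑antidiagonal (suc n) g ≡ ∑antidiagonal (suc n) f + ∑antidiagonal n f′
∑antidiagonal-split zero f g f′ e₊ e₀ = begin
  g 0 1 + g 1 0             ≡⟨ cong₂ _+_ (e₊ 0 0) (e₀ 1) ⟩
  (f 0 1 + f′ 0 0) + f 1 0  ≡⟨ +-assoc (f 0 1) _ _ ⟩
  f 0 1 + (f′ 0 0 + f 1 0)  ≡⟨ cong (f 0 1 +_) (+-comm (f′ 0 0) (f 1 0)) ⟩
  f 0 1 + (f 1 0 + f′ 0 0)  ≡⟨ +-assoc (f 0 1) _ _ ⟨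
  (f 0 1 + f 1 0) + f′ 0 0  ∎
  where open ≡-Reasoning
∑antidiagonal-split (suc n) f g f′ e₊ e₀ = begin
  g 0 (2 + n) + ∑antidiagonal (suc n) (g ∘ suc)
    ≡⟨ cong₂ _+_ (e₊ 0 (suc n))
                 (∑antidiagonal-split n (f ∘ suc) (g ∘ suc) (f′ ∘ suc) (e₊ ∘ suc) (e₀ ∘ suc)) ⟩
  (f 0 (2 + n) + f′ 0 (suc n)) + (∑antidiagonal (suc n) (f ∘ suc) + ∑antidiagonal n (f′ ∘ suc))
    ≡⟨ interchange (f 0 (2 + n)) _ _ _ ⟩
  ∑antidiagonal (2 + n) f + ∑antidiagonal (suc n) f′ ∎
  where open ≡-Reasoning

areaBinomial : ℕ → ℕ → ℕ → ℕ → ℕ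
areaBinomial k h c d = ∑ (words k) (λ w → (c + areaFrom h w) C d)

closedForm : ℕ → ℕ → ℕ → ℕ
closedForm len h c = ∑antidiagonal len (λ k d → areaBinomial k h c d)

∑-words-suc : (k : ℕ) (g : List Bool → ℕ) →
              ∑ (words (suc k)) g ≡ ∑ (words k) (g ∘ (true ∷_)) + ∑ (words k) (g ∘ (false ∷_))
∑-words-suc k g = begin
  ∑ (words (suc k)) g
    ≡⟨ ∑-concatMap (λ w → (true ∷ w) ∷ (false ∷ w) ∷ []) (words k) g ⟩
  ∑ (words k) (λ w → g (true ∷ w) + (g (false ∷ w) + 0))
    ≡⟨ ∑-cong (words k) (λ w → cong (g (true ∷ w) +_) (+-identityʳ _)) ⟩
  ∑ (words k) (λ w → g (true ∷ w) + g (false ∷ w))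
    ≡⟨ ∑-+ (words k) _ _ ⟩
  ∑ (words k) (g ∘ (true ∷_)) + ∑ (words k) (g ∘ (false ∷_)) ∎
  where open ≡-Reasoning

areaBinomial-zero : ∀ h c d → areaBinomial 0 h c d ≡ c C d
areaBinomial-zero h c d = trans (+-identityʳ _) (cong (_C d) (+-identityʳ c))

areaBinomial-suc : ∀ k h c d →
  areaBinomial (suc k) h c d ≡ areaBinomial k h (c + h) d + areaBinomial k (suc h) c d
areaBinomial-suc k h c d = trans (∑-words-suc k (λ w → (c + areaFrom h w) C d))
  (cong (_+ areaBinomial k (suc h) c d)
        (∑-cong (words k) (λ w → cong (_C d) (sym (+-assoc c h (areaFrom h w))))))

areaBinomial-pascal : ∀ k h c d →
  areaBinomial k h (suc c) (suc d) ≡ areaBinomial k h c (suc d) + areaBinomial k h c d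
areaBinomial-pascal k h c d = trans
  (∑-cong (words k) (λ w → sym (trans (+-comm ((c + areaFrom h w) C suc d) _) (nCk+nC[k+1]≡[n+1]C[k+1] _ d))))
  (∑-+ (words k) _ _)

closedForm-pascal : ∀ n h c → closedForm (suc n) h (suc c) ≡ closedForm (suc n) h c + closedForm n h c
closedForm-pascal n h c =
  ∑antidiagonal-split n (λ k → areaBinomial k h c) (λ k → areaBinomial k h (suc c)) (λ k → areaBinomial k h c)
    (λ k d → areaBinomial-pascal k h c d) (λ k → refl)

closedForm-suc : ∀ n h c →
  closedForm (suc n) h c ≡ c C suc n + (closedForm n h (c + h) + closedForm n (suc h) c)
closedForm-suc n h c = cong₂ _+_ (areaBinomial-zero h c (suc n))
  (trans (∑antidiagonal-cong n (λ k d → areaBinomial-suc k h c d)) (∑antidiagonal-+ n _ _))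

-- The number of nodes len levels below a node labelled (h, c) in the generating tree.
descendants : ℕ → ℕ → ℕ → ℕ
descendants zero      h c = 1
descendants (suc len) h c = descendants len h h + descendants len (suc h) 0 + ∑< c (descendants len h)

descendants≡closedForm : ∀ len h c → descendants len h c ≡ closedForm len h c
descendants≡closedForm zero      h c = sym (areaBinomial-zero h c 0)
descendants≡closedForm (suc len) h = go
  where
  go : ∀ c → descendants (suc len) h c ≡ closedForm (suc len) h c
  go zero    = trans (+-identityʳ _)
    (trans (cong₂ _+_ (descendants≡closedForm len h h) (descendants≡closedForm len (suc h) 0))
           (sym (closedForm-suc len h 0)))
  go (suc c) = begin
    descendants len h h + descendants len (suc h) 0 + ∑< (suc c) (descendants len h)
      ≡⟨ cong (descendants len h h + descendants len (suc h) 0 +_) (∑<-suc c (descendants len h)) ⟩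
    descendants len h h + descendants len (suc h) 0 + (∑< c (descendants len h) + descendants len h c)
      ≡⟨ +-assoc (descendants len h h + descendants len (suc h) 0) _ _ ⟨
    descendants (suc len) h c + descendants len h c
      ≡⟨ cong₂ _+_ (go c) (descendants≡closedForm len h c) ⟩
    closedForm (suc len) h c + closedForm len h c
      ≡⟨ closedForm-pascal len h c ⟨
    closedForm (suc len) h (suc c) ∎
    where open ≡-Reasoning

coeff-⊕ : ∀ p q k → coeff (p ⊕ q) k ≡ coeff p k + coeff q k
coeff-⊕ []      q       k       = refl
coeff-⊕ (a ∷ p) []      k       = sym (+-identityʳ _)
coeff-⊕ (a ∷ p) (b ∷ q) zero    = refl
coeff-⊕ (a ∷ p) (b ∷ q) (suc k) = coeff-⊕ p q k

coeff-scale : ∀ a q k → coeff (scale a q) k ≡ a * coeff q k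
coeff-scale a []      k       = sym (*-zeroʳ a)
coeff-scale a (b ∷ q) zero    = refl
coeff-scale a (b ∷ q) (suc k) = coeff-scale a q k

coeff-scale-1 : ∀ q k → coeff (scale 1 q) k ≡ coeff q k
coeff-scale-1 q k = trans (coeff-scale 1 q k) (*-identityˡ _)

coeff-[1+x]⊗-zero : ∀ r → coeff (onePlusX ⊗ r) 0 ≡ coeff r 0
coeff-[1+x]⊗-zero r = trans (coeff-⊕ (scale 1 r) _ 0) (trans (+-identityʳ _) (coeff-scale-1 r 0))

coeff-[1+x]⊗-suc : ∀ r k → coeff (onePlusX ⊗ r) (suc k) ≡ coeff r (suc k) + coeff r k
coeff-[1+x]⊗-suc r k = trans (coeff-⊕ (scale 1 r) _ (suc k)) (cong₂ _+_ (coeff-scale-1 r (suc k))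
  (trans (coeff-⊕ (scale 1 r) (0 ∷ []) k) (trans (cong₂ _+_ (coeff-scale-1 r k) (coeff-0 k)) (+-identityʳ _))))
  where
  coeff-0 : ∀ k → coeff (0 ∷ []) k ≡ 0
  coeff-0 zero    = refl
  coeff-0 (suc k) = refl

coeff-∷∘[1+x]-zero : ∀ c p → coeff (compose (c ∷ p) onePlusX) 0 ≡ c + coeff (compose p onePlusX) 0
coeff-∷∘[1+x]-zero c p = trans (coeff-⊕ (c ∷ []) (onePlusX ⊗ compose p onePlusX) 0)
                               (cong (c +_) (coeff-[1+x]⊗-zero (compose p onePlusX)))

coeff-∷∘[1+x]-suc : ∀ c p k → coeff (compose (c ∷ p) onePlusX) (suc k) ≡
                    coeff (compose p onePlusX) (suc k) + coeff (compose p onePlusX) k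
coeff-∷∘[1+x]-suc c p k = trans (coeff-⊕ (c ∷ []) (onePlusX ⊗ compose p onePlusX) (suc k))
                                (coeff-[1+x]⊗-suc (compose p onePlusX) k)

coeff-⊕∘[1+x] : ∀ p q k → coeff (compose (p ⊕ q) onePlusX) k ≡
                coeff (compose p onePlusX) k + coeff (compose q onePlusX) k
coeff-⊕∘[1+x] []      q       k       = refl
coeff-⊕∘[1+x] (a ∷ p) []      k       = sym (+-identityʳ _)
coeff-⊕∘[1+x] (a ∷ p) (b ∷ q) zero    = begin
  coeff (compose ((a + b) ∷ (p ⊕ q)) onePlusX) 0
    ≡⟨ coeff-∷∘[1+x]-zero (a + b) (p ⊕ q) ⟩
  (a + b) + coeff (compose (p ⊕ q) onePlusX) 0
    ≡⟨ cong ((a + b) +_) (coeff-⊕∘[1+x] p q 0) ⟩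
  (a + b) + (coeff (compose p onePlusX) 0 + coeff (compose q onePlusX) 0)
    ≡⟨ interchange a b _ _ ⟩
  (a + coeff (compose p onePlusX) 0) + (b + coeff (compose q onePlusX) 0)
    ≡⟨ cong₂ _+_ (coeff-∷∘[1+x]-zero a p) (coeff-∷∘[1+x]-zero b q) ⟨
  coeff (compose (a ∷ p) onePlusX) 0 + coeff (compose (b ∷ q) onePlusX) 0 ∎
  where open ≡-Reasoning
coeff-⊕∘[1+x] (a ∷ p) (b ∷ q) (suc k) = begin
  coeff (compose ((a + b) ∷ (p ⊕ q)) onePlusX) (suc k)
    ≡⟨ coeff-∷∘[1+x]-suc (a + b) (p ⊕ q) k ⟩
  coeff (compose (p ⊕ q) onePlusX) (suc k) + coeff (compose (p ⊕ q) onePlusX) k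
    ≡⟨ cong₂ _+_ (coeff-⊕∘[1+x] p q (suc k)) (coeff-⊕∘[1+x] p q k) ⟩
  (coeff (compose p onePlusX) (suc k) + coeff (compose q onePlusX) (suc k)) +
  (coeff (compose p onePlusX) k + coeff (compose q onePlusX) k)
    ≡⟨ interchange (coeff (compose p onePlusX) (suc k)) _ _ _ ⟩
  (coeff (compose p onePlusX) (suc k) + coeff (compose p onePlusX) k) +
  (coeff (compose q onePlusX) (suc k) + coeff (compose q onePlusX) k)
    ≡⟨ cong₂ _+_ (coeff-∷∘[1+x]-suc a p k) (coeff-∷∘[1+x]-suc b q k) ⟨
  coeff (compose (a ∷ p) onePlusX) (suc k) + coeff (compose (b ∷ q) onePlusX) (suc k) ∎
  where open ≡-Reasoning

coeff-polySum : ∀ ps k → coeff (polySum ps) k ≡ ∑ ps (λ p → coeff p k)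
coeff-polySum []       k = refl
coeff-polySum (p ∷ ps) k = trans (coeff-⊕ p (polySum ps) k) (cong (coeff p k +_) (coeff-polySum ps k))

coeff-polySum∘[1+x] : ∀ ps k →
  coeff (compose (polySum ps) onePlusX) k ≡ ∑ ps (λ p → coeff (compose p onePlusX) k)
coeff-polySum∘[1+x] []       k = refl
coeff-polySum∘[1+x] (p ∷ ps) k =
  trans (coeff-⊕∘[1+x] p (polySum ps) k) (cong (coeff (compose p onePlusX) k +_) (coeff-polySum∘[1+x] ps k))

coeff-monomial∘[1+x] : ∀ a k → coeff (compose (monomial a) onePlusX) k ≡ a C k
coeff-monomial∘[1+x] zero    zero    = coeff-∷∘[1+x]-zero 1 []
coeff-monomial∘[1+x] zero    (suc k) = trans (coeff-∷∘[1+x]-suc 1 [] k) (sym (k>n⇒nCk≡0 {0} {suc k} z<s))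
coeff-monomial∘[1+x] (suc a) zero    = trans (coeff-∷∘[1+x]-zero 0 (monomial a)) (coeff-monomial∘[1+x] a 0)
coeff-monomial∘[1+x] (suc a) (suc k) = begin
  coeff (compose (monomial (suc a)) onePlusX) (suc k)
    ≡⟨ coeff-∷∘[1+x]-suc 0 (monomial a) k ⟩
  coeff (compose (monomial a) onePlusX) (suc k) + coeff (compose (monomial a) onePlusX) k
    ≡⟨ cong₂ _+_ (coeff-monomial∘[1+x] a (suc k)) (coeff-monomial∘[1+x] a k) ⟩
  a C suc k + a C k
    ≡⟨ +-comm (a C suc k) (a C k) ⟩
  a C k + a C suc k
    ≡⟨ nCk+nC[k+1]≡[n+1]C[k+1] a k ⟩
  suc a C suc k ∎
  where open ≡-Reasoning

eastCount<suc-words : ∀ k → All (λ w → eastCount w < suc k) (words k)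
eastCount<suc-words zero    = z<s ∷ []
eastCount<suc-words (suc k) =
  All.concat⁺ (All.map⁺ (All.map (λ {w} lt → s<s lt ∷ m<n⇒m<1+n lt ∷ []) (eastCount<suc-words k)))

-- L_k(1 + x) = Σ_w (1 + x)^(area w), w ranging over all paths of length k.
coeff-L∘[1+x] : ∀ k d → coeff (compose (Lpoly k) onePlusX) d ≡ areaBinomial k 0 0 d
coeff-L∘[1+x] k d = begin
  coeff (compose (Lpoly k) onePlusX) d
    ≡⟨ coeff-polySum∘[1+x] (map (gauss k) (upTo′ k)) d ⟩
  ∑ (map (gauss k) (upTo′ k)) (λ p → coeff (compose p onePlusX) d)
    ≡⟨ ∑-map (upTo′ k) (gauss k) _ ⟩
  ∑ (upTo′ k) (λ m → coeff (compose (gauss k m) onePlusX) d)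
    ≡⟨ ∑-upTo (suc k) _ ⟩
  ∑< (suc k) (λ m → coeff (compose (gauss k m) onePlusX) d)
    ≡⟨ ∑<-cong (suc k) coeff-gauss∘[1+x] ⟩
  ∑< (suc k) (λ m → ∑ (paths k m) (λ w → area w C d))
    ≡⟨ ∑<-fibres eastCount (suc k) (words k) _ (eastCount<suc-words k) ⟩
  areaBinomial k 0 0 d ∎
  where
  open ≡-Reasoning
  coeff-gauss∘[1+x] : ∀ m → coeff (compose (gauss k m) onePlusX) d ≡ ∑ (paths k m) (λ w → area w C d)
  coeff-gauss∘[1+x] m = begin
    coeff (compose (gauss k m) onePlusX) d
      ≡⟨ coeff-polySum∘[1+x] (map (monomial ∘ area) (paths k m)) d ⟩
    ∑ (map (monomial ∘ area) (paths k m)) (λ p → coeff (compose p onePlusX) d)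
      ≡⟨ ∑-map (paths k m) (monomial ∘ area) _ ⟩
    ∑ (paths k m) (λ w → coeff (compose (monomial (area w)) onePlusX) d)
      ≡⟨ ∑-cong (paths k m) (λ w → coeff-monomial∘[1+x] (area w) d) ⟩
    ∑ (paths k m) (λ w → area w C d) ∎

coeff-shift-below : ∀ n p → coeff (shift (suc n) p) n ≡ 0
coeff-shift-below zero    p = refl
coeff-shift-below (suc n) p = coeff-shift-below n p

∑<-coeff-shift : ∀ n (F : ℕ → Poly) →
  ∑< (suc n) (λ k → coeff (shift k (F k)) n) ≡ ∑antidiagonal n (λ k → coeff (F k))
∑<-coeff-shift zero    F = +-identityʳ _
∑<-coeff-shift (suc n) F = cong (coeff (F 0) (suc n) +_) (∑<-coeff-shift n (F ∘ suc))

coeff-rhsPartial : ∀ N n → coeff (rhsPartial N) n ≡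
  coeff (1 ∷ []) n + ∑< (suc N) (λ k → coeff (shift (suc k) (compose (Lpoly k) onePlusX)) n)
coeff-rhsPartial N n = begin
  coeff (rhsPartial N) n
    ≡⟨ coeff-⊕ (1 ∷ []) (polySum (map term (upTo′ N))) n ⟩
  coeff (1 ∷ []) n + coeff (polySum (map term (upTo′ N))) n
    ≡⟨ cong (coeff (1 ∷ []) n +_) (coeff-polySum (map term (upTo′ N)) n) ⟩
  coeff (1 ∷ []) n + ∑ (map term (upTo′ N)) (λ p → coeff p n)
    ≡⟨ cong (coeff (1 ∷ []) n +_) (trans (∑-map (upTo′ N) term _) (∑-upTo (suc N) _)) ⟩
  coeff (1 ∷ []) n + ∑< (suc N) (λ k → coeff (term k) n) ∎
  where
  open ≡-Reasoning
  term : ℕ → Poly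
  term k = shift (suc k) (compose (Lpoly k) onePlusX)

rhsCoeff-zero : rhsCoeff 0 ≡ 1
rhsCoeff-zero = coeff-rhsPartial 0 0

rhsCoeff-suc : ∀ n → rhsCoeff (suc n) ≡ closedForm n 0 0
rhsCoeff-suc n = begin
  rhsCoeff (suc n)
    ≡⟨ coeff-rhsPartial (suc n) (suc n) ⟩
  ∑< (2 + n) (λ k → coeff (shift k (P k)) n)
    ≡⟨ ∑<-suc (suc n) (λ k → coeff (shift k (P k)) n) ⟩
  ∑< (suc n) (λ k → coeff (shift k (P k)) n) + coeff (shift (suc n) (P (suc n))) n
    ≡⟨ cong₂ _+_ (∑<-coeff-shift n P) (coeff-shift-below n (P (suc n))) ⟩
  ∑antidiagonal n (λ k → coeff (P k)) + 0
    ≡⟨ +-identityʳ _ ⟩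
  ∑antidiagonal n (λ k → coeff (P k))
    ≡⟨ ∑antidiagonal-cong n coeff-L∘[1+x] ⟩
  closedForm n 0 0 ∎
  where
  open ≡-Reasoning
  P : ℕ → Poly
  P k = compose (Lpoly k) onePlusX

trues : List Bool → ℕ
trues = eastCount

nthBit : List Bool → ℕ → Bool
nthBit []       _       = false
nthBit (b ∷ bs) zero    = b
nthBit (b ∷ bs) (suc j) = nthBit bs j

EndsInTrue : List Bool → Set
EndsInTrue []           = ⊥
EndsInTrue (b ∷ [])     = b ≡ true
EndsInTrue (_ ∷ c ∷ bs) = EndsInTrue (c ∷ bs)

EndsInTrue⇒trues≡suc : ∀ bs → EndsInTrue bs → trues bs ≡ suc (trues bs ∸ 1)
EndsInTrue⇒trues≡suc (true ∷ [])      refl = refl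
EndsInTrue⇒trues≡suc (true ∷ c ∷ bs)  _    = refl
EndsInTrue⇒trues≡suc (false ∷ c ∷ bs) e    = EndsInTrue⇒trues≡suc (c ∷ bs) e

-- The effect on the right-to-left-minimum word of inserting a new maximum at position i:
-- the new entry is a right-to-left minimum only if it comes last.
insertMaxBit : ℕ → List Bool → List Bool
insertMaxBit _       []       = true ∷ []
insertMaxBit zero    (b ∷ bs) = false ∷ b ∷ bs
insertMaxBit (suc i) (b ∷ bs) = b ∷ insertMaxBit i bs

trues-insertMaxBit : ∀ i bs → i ≤ length bs →
                     trues (insertMaxBit i bs) ≡ trues bs + (if null (drop i bs) then 1 else 0)
trues-insertMaxBit zero    []           _         = refl
trues-insertMaxBit zero    (b ∷ bs)     _         = sym (+-identityʳ _)
trues-insertMaxBit (suc i) (true ∷ bs)  (s≤s i≤n) = cong suc (trues-insertMaxBit i bs i≤n)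
trues-insertMaxBit (suc i) (false ∷ bs) (s≤s i≤n) = trues-insertMaxBit i bs i≤n

drop-insertMaxBit : ∀ i bs → i ≤ length bs → drop i (insertMaxBit i bs) ≡ insertMaxBit 0 (drop i bs)
drop-insertMaxBit zero    bs       _         = refl
drop-insertMaxBit (suc i) (b ∷ bs) (s≤s i≤n) = drop-insertMaxBit i bs i≤n

-- A node is described by its right-to-left-minimum word bs and the position p of its maximum;
-- its label is (h, c) with h + 1 right-to-left minima in all and c + 1 of them from position p on.
weight : ℕ → List Bool → ℕ → ℕ
weight len bs p = descendants len (trues bs ∸ 1) (trues (drop p bs) ∸ 1)

childWeight : ℕ → List Bool → ℕ → ℕ
childWeight len bs i = weight len (insertMaxBit i bs) i

-- Site 0 is always active, site j + 1 iff entry j is a right-to-left minimum at or after the maximum.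
activeSite : List Bool → ℕ → ℕ → Bool
activeSite bs p zero    = true
activeSite bs p (suc j) = (p <ᵇ suc j) ∧ nthBit bs j

weightAfter : ℕ → ℕ → List Bool → ℕ
weightAfter len h []      = descendants len (suc h) 0
weightAfter len h (b ∷ d) = descendants len h (trues (b ∷ d) ∸ 1)

childWeight-suc : ∀ len bs j → suc j ≤ length bs → EndsInTrue bs →
                  childWeight len bs (suc j) ≡ weightAfter len (trues bs ∸ 1) (drop (suc j) bs)
childWeight-suc len bs j j<n end with drop (suc j) bs in eq
... | [] = cong₂ (descendants len)
  (begin
     trues (insertMaxBit (suc j) bs) ∸ 1
       ≡⟨ cong (_∸ 1) (trues-insertMaxBit (suc j) bs j<n) ⟩
     trues bs + (if null (drop (suc j) bs) then 1 else 0) ∸ 1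
       ≡⟨ cong (λ rest → trues bs + (if null rest then 1 else 0) ∸ 1) eq ⟩
     trues bs + 1 ∸ 1
       ≡⟨ m+n∸n≡m (trues bs) 1 ⟩
     trues bs
       ≡⟨ EndsInTrue⇒trues≡suc bs end ⟩
     suc (trues bs ∸ 1) ∎)
  (cong (λ w → trues w ∸ 1) (trans (drop-insertMaxBit (suc j) bs j<n) (cong (insertMaxBit 0) eq)))
  where open ≡-Reasoning
... | b ∷ d = cong₂ (descendants len)
  (cong (_∸ 1) (trans (trues-insertMaxBit (suc j) bs j<n)
                      (trans (cong (λ rest → trues bs + (if null rest then 1 else 0)) eq) (+-identityʳ _))))
  (cong (λ w → trues w ∸ 1) (trans (drop-insertMaxBit (suc j) bs j<n) (cong (insertMaxBit 0) eq)))

∑-weightAfter : ∀ len h bs p → EndsInTrue bs → p < length bs →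
  ∑< (length bs) (λ j → if (p <ᵇ suc j) ∧ nthBit bs j then weightAfter len h (drop (suc j) bs) else 0)
    ≡ descendants len (suc h) 0 + ∑< (trues (drop p bs) ∸ 1) (descendants len h)
∑-weightAfter len h (true ∷ [])      zero    refl _         = refl
∑-weightAfter len h (true ∷ [])      (suc p) refl (s<s ())
∑-weightAfter len h (b ∷ c ∷ bs)     (suc p) end  (s<s p<n) = ∑-weightAfter len h (c ∷ bs) p end p<n
∑-weightAfter len h (false ∷ c ∷ bs) zero    end  _         = ∑-weightAfter len h (c ∷ bs) zero end z<s
∑-weightAfter len h (true ∷ c ∷ bs)  zero    end  _         = begin
  descendants len h k +
  ∑< (length (c ∷ bs)) (λ j → if nthBit (c ∷ bs) j then weightAfter len h (drop (suc j) (c ∷ bs)) else 0)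
    ≡⟨ cong (descendants len h k +_) (∑-weightAfter len h (c ∷ bs) zero end z<s) ⟩
  descendants len h k + (descendants len (suc h) 0 + ∑< k (descendants len h))
    ≡⟨ +-comm (descendants len h k) _ ⟩
  (descendants len (suc h) 0 + ∑< k (descendants len h)) + descendants len h k
    ≡⟨ +-assoc (descendants len (suc h) 0) _ _ ⟩
  descendants len (suc h) 0 + (∑< k (descendants len h) + descendants len h k)
    ≡⟨ cong (descendants len (suc h) 0 +_) (∑<-suc k (descendants len h)) ⟨
  descendants len (suc h) 0 + ∑< (suc k) (descendants len h)
    ≡⟨ cong (λ n → descendants len (suc h) 0 + ∑< n (descendants len h))
            (EndsInTrue⇒trues≡suc (c ∷ bs) end) ⟨
  descendants len (suc h) 0 + ∑< (trues (c ∷ bs)) (descendants len h) ∎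
  where
  open ≡-Reasoning
  k = trues (c ∷ bs) ∸ 1

∑-childWeight : ∀ len bs p → EndsInTrue bs → p < length bs →
  ∑< (suc (length bs)) (λ i → if activeSite bs p i then childWeight len bs i else 0) ≡ weight (suc len) bs p
∑-childWeight len bs@(_ ∷ _) p end p<n = begin
  childWeight len bs 0 +
  ∑< (length bs) (λ j → if (p <ᵇ suc j) ∧ nthBit bs j then childWeight len bs (suc j) else 0)
    ≡⟨ cong (childWeight len bs 0 +_) (∑<-cong-< (length bs) (λ j j<n →
         cong (if (p <ᵇ suc j) ∧ nthBit bs j then_else 0) (childWeight-suc len bs j j<n end))) ⟩
  descendants len h h +
  ∑< (length bs) (λ j → if (p <ᵇ suc j) ∧ nthBit bs j then weightAfter len h (drop (suc j) bs) else 0)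
    ≡⟨ cong (descendants len h h +_) (∑-weightAfter len h bs p end p<n) ⟩
  descendants len h h + (descendants len (suc h) 0 + ∑< (trues (drop p bs) ∸ 1) (descendants len h))
    ≡⟨ +-assoc (descendants len h h) _ _ ⟨
  weight (suc len) bs p ∎
  where
  open ≡-Reasoning
  h = trues bs ∸ 1

insertAt : ℕ → ℕ → List ℕ → List ℕ
insertAt zero    m l       = m ∷ l
insertAt (suc i) m []      = m ∷ []
insertAt (suc i) m (x ∷ l) = x ∷ insertAt i m l

indexOf : ℕ → List ℕ → ℕ
indexOf M []      = 0
indexOf M (x ∷ l) with x ≟ M
... | yes _ = 0
... | no  _ = suc (indexOf M l)

remove : ℕ → List ℕ → List ℕ
remove M []      = []
remove M (x ∷ l) with x ≟ M
... | yes _ = l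
... | no  _ = x ∷ remove M l

length-insertAt : ∀ i m l → length (insertAt i m l) ≡ suc (length l)
length-insertAt zero    m l       = refl
length-insertAt (suc i) m []      = refl
length-insertAt (suc i) m (x ∷ l) = cong suc (length-insertAt i m l)

∈-insertAt⁻ : ∀ {x} i m l → x ∈ insertAt i m l → x ≡ m ⊎ x ∈ l
∈-insertAt⁻ zero    m l       (here p)  = inj₁ p
∈-insertAt⁻ zero    m l       (there p) = inj₂ p
∈-insertAt⁻ (suc i) m []      (here p)  = inj₁ p
∈-insertAt⁻ (suc i) m (y ∷ l) (here p)  = inj₂ (here p)
∈-insertAt⁻ (suc i) m (y ∷ l) (there p) = Sum.map₂ there (∈-insertAt⁻ i m l p)

∈-insertAt-self : ∀ i m l → m ∈ insertAt i m l
∈-insertAt-self zero    m l       = here refl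
∈-insertAt-self (suc i) m []      = here refl
∈-insertAt-self (suc i) m (x ∷ l) = there (∈-insertAt-self i m l)

∈-insertAt⁺ : ∀ {x} i m l → x ∈ l → x ∈ insertAt i m l
∈-insertAt⁺ zero    m l       p         = there p
∈-insertAt⁺ (suc i) m (y ∷ l) (here p)  = here p
∈-insertAt⁺ (suc i) m (y ∷ l) (there p) = there (∈-insertAt⁺ i m l p)

All-insertAt⁺ : ∀ {P : ℕ → Set} i m l → P m → All P l → All P (insertAt i m l)
All-insertAt⁺ zero    m l       pm ps         = pm ∷ ps
All-insertAt⁺ (suc i) m []      pm []         = pm ∷ []
All-insertAt⁺ (suc i) m (x ∷ l) pm (px ∷ ps) = px ∷ All-insertAt⁺ i m l pm ps

All-insertAt⁻ : ∀ {P : ℕ → Set} i m l → All P (insertAt i m l) → All P l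
All-insertAt⁻ zero    m l       (_ ∷ ps)  = ps
All-insertAt⁻ (suc i) m []      _         = []
All-insertAt⁻ (suc i) m (x ∷ l) (px ∷ ps) = px ∷ All-insertAt⁻ i m l ps

unique-insertAt⁺ : ∀ i m l → m ∉ l → Unique l → Unique (insertAt i m l)
unique-insertAt⁺ zero    m l       m∉l u =
  All.tabulate (λ y∈l m≡y → m∉l (subst (_∈ l) (sym m≡y) y∈l)) ∷ u
unique-insertAt⁺ (suc i) m []      m∉l u = [] ∷ []
unique-insertAt⁺ (suc i) m (x ∷ l) m∉l (x∉l ∷ u) =
  All-insertAt⁺ i m l (λ x≡m → m∉l (here (sym x≡m))) x∉l ∷ unique-insertAt⁺ i m l (m∉l ∘ there) u

unique-insertAt⁻ : ∀ i m l → Unique (insertAt i m l) → Unique l × m ∉ l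
unique-insertAt⁻ zero    m l       (m∉l ∷ u) = u , λ m∈l → All.lookup m∉l m∈l refl
unique-insertAt⁻ (suc i) m []      u         = [] , λ ()
unique-insertAt⁻ (suc i) m (x ∷ l) (x∉ ∷ u) with unique-insertAt⁻ i m l u
... | u′ , m∉l = (All-insertAt⁻ i m l x∉ ∷ u′) , λ
  { (here m≡x) → All.lookup x∉ (∈-insertAt-self i m l) (sym m≡x)
  ; (there m∈l) → m∉l m∈l }

indexOf-insertAt : ∀ i m l → m ∉ l → i ≤ length l → indexOf m (insertAt i m l) ≡ i
indexOf-insertAt zero m l m∉l _ with m ≟ m
... | yes _   = refl
... | no  m≢m = ⊥-elim (m≢m refl)
indexOf-insertAt (suc i) m (x ∷ l) m∉l (s≤s i≤n) with x ≟ m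
... | yes x≡m = ⊥-elim (m∉l (here (sym x≡m)))
... | no  _   = cong suc (indexOf-insertAt i m l (m∉l ∘ there) i≤n)

remove-insertAt : ∀ i m l → m ∉ l → remove m (insertAt i m l) ≡ l
remove-insertAt zero m l m∉l with m ≟ m
... | yes _   = refl
... | no  m≢m = ⊥-elim (m≢m refl)
remove-insertAt (suc i) m [] m∉l with m ≟ m
... | yes _   = refl
... | no  m≢m = ⊥-elim (m≢m refl)
remove-insertAt (suc i) m (x ∷ l) m∉l with x ≟ m
... | yes x≡m = ⊥-elim (m∉l (here (sym x≡m)))
... | no  _   = cong (x ∷_) (remove-insertAt i m l (m∉l ∘ there))

insertAt-indexOf-remove : ∀ M l → M ∈ l → insertAt (indexOf M l) M (remove M l) ≡ l
insertAt-indexOf-remove M (x ∷ l) M∈ with x ≟ M | M∈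
... | yes x≡M | _          = cong (_∷ l) (sym x≡M)
... | no  x≢M | here M≡x   = ⊥-elim (x≢M (sym M≡x))
... | no  _   | there M∈l = cong (x ∷_) (insertAt-indexOf-remove M l M∈l)

indexOf<length : ∀ M l → M ∈ l → indexOf M l < length l
indexOf<length M (x ∷ l) M∈ with x ≟ M | M∈
... | yes _   | _          = z<s
... | no  x≢M | here M≡x   = ⊥-elim (x≢M (sym M≡x))
... | no  _   | there M∈l = s<s (indexOf<length M l M∈l)

indexOf<⇔∈take : ∀ M l k → M ∈ l → indexOf M l < k ⇔ M ∈ take k l
indexOf<⇔∈take M l k M∈ = mk⇔ (to l k M∈) (from l k)
  where
  to : ∀ l k → M ∈ l → indexOf M l < k → M ∈ take k l
  to (x ∷ l) (suc k) M∈ lt with x ≟ M | M∈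
  ... | yes x≡M | _          = here (sym x≡M)
  ... | no  x≢M | here M≡x   = ⊥-elim (x≢M (sym M≡x))
  ... | no  _   | there M∈l = there (to l k M∈l (s<s⁻¹ lt))
  from : ∀ l k → M ∈ take k l → indexOf M l < k
  from (x ∷ l) (suc k) M∈ with x ≟ M | M∈
  ... | yes _   | _          = z<s
  ... | no  x≢M | here M≡x   = ⊥-elim (x≢M (sym M≡x))
  ... | no  _   | there M∈l = s<s (from l k M∈l)

record IsPermutation (m : ℕ) (l : List ℕ) : Set where
  constructor isPermutation
  field
    length≡  : length l ≡ m
    unique   : Unique l
    bounded  : All (_< m) l
    complete : ∀ x → x < m → x ∈ l

bounded⇒∉ : ∀ {m l} → All (_< m) l → m ∉ l
bounded⇒∉ bounded m∈l = <-irrefl refl (All.lookup bounded m∈l)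

IsPermutation-insertAt : ∀ {m σ} i → IsPermutation m σ → IsPermutation (suc m) (insertAt i m σ)
IsPermutation-insertAt {m} {σ} i (isPermutation len u bounded complete) = isPermutation
  (trans (length-insertAt i m σ) (cong suc len))
  (unique-insertAt⁺ i m σ (bounded⇒∉ bounded) u)
  (All-insertAt⁺ i m σ ≤-refl (All.map m<n⇒m<1+n bounded))
  complete′
  where
  complete′ : ∀ x → x < suc m → x ∈ insertAt i m σ
  complete′ x x<1+m with m≤n⇒m<n∨m≡n (s≤s⁻¹ x<1+m)
  ... | inj₁ x<m  = ∈-insertAt⁺ i m σ (complete x x<m)
  ... | inj₂ refl = ∈-insertAt-self i x σ

IsPermutation-remove : ∀ {m π} → IsPermutation (suc m) π →
  insertAt (indexOf m π) m (remove m π) ≡ π × IsPermutation m (remove m π) × indexOf m π ≤ m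
IsPermutation-remove {m} {π} (isPermutation len u bounded complete) =
  π≡ , isPermutation len′ u′ bounded′ complete′ , s≤s⁻¹ (subst (i <_) len (indexOf<length m π m∈π))
  where
  m∈π = complete m ≤-refl
  σ = remove m π
  i = indexOf m π
  π≡ : insertAt i m σ ≡ π
  π≡ = insertAt-indexOf-remove m π m∈π
  u′,m∉σ : Unique σ × m ∉ σ
  u′,m∉σ = unique-insertAt⁻ i m σ (subst Unique (sym π≡) u)
  u′ = proj₁ u′,m∉σ
  len′ : length σ ≡ m
  len′ = suc-injective (trans (sym (length-insertAt i m σ)) (trans (cong length π≡) len))
  bounded′ : All (_< m) σ
  bounded′ = All.tabulate (λ {x} x∈σ → lt x x∈σ)
    where
    lt : ∀ x → x ∈ σ → x < m
    lt x x∈σ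
      with m≤n⇒m<n∨m≡n (s≤s⁻¹ (All.lookup bounded (subst (x ∈_) π≡ (∈-insertAt⁺ i m σ x∈σ))))
    ... | inj₁ x<m  = x<m
    ... | inj₂ refl = ⊥-elim (proj₂ u′,m∉σ x∈σ)
  complete′ : ∀ x → x < m → x ∈ σ
  complete′ x x<m with ∈-insertAt⁻ i m σ (subst (x ∈_) (sym π≡) (complete x (m<n⇒m<1+n x<m)))
  ... | inj₁ refl = ⊥-elim (<-irrefl refl x<m)
  ... | inj₂ x∈σ  = x∈σ

rlMinima : List ℕ → List Bool
rlMinima []      = []
rlMinima (x ∷ l) = does (all? (x <?_) l) ∷ rlMinima l

length-rlMinima : ∀ l → length (rlMinima l) ≡ length l
length-rlMinima []      = refl
length-rlMinima (x ∷ l) = cong suc (length-rlMinima l)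

EndsInTrue-rlMinima : ∀ x l → EndsInTrue (rlMinima (x ∷ l))
EndsInTrue-rlMinima x []      = refl
EndsInTrue-rlMinima x (y ∷ l) = EndsInTrue-rlMinima y l

rlMinima-insertAt : ∀ i m σ → All (_< m) σ → rlMinima (insertAt i m σ) ≡ insertMaxBit i (rlMinima σ)
rlMinima-insertAt zero    m []      _ = refl
rlMinima-insertAt zero    m (x ∷ l) (x<m ∷ _) =
  cong (_∷ rlMinima (x ∷ l)) (dec-false (all? (m <?_) (x ∷ l)) λ { (m<x ∷ _) → <-asym m<x x<m })
rlMinima-insertAt (suc i) m []      _ = refl
rlMinima-insertAt (suc i) m (x ∷ l) (x<m ∷ bounded) = cong₂ _∷_
  (does-⇔ (mk⇔ (All-insertAt⁻ i m l) (All-insertAt⁺ i m l x<m)) (all? (x <?_) (insertAt i m l)) (all? (x <?_) l))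
  (rlMinima-insertAt i m l bounded)

AllTails : (ℕ → List ℕ → Set) → List ℕ → Set
AllTails P []      = ⊤
AllTails P (x ∷ l) = P x l × AllTails P l

-- x followed by l: x is not the first entry of an occurrence of p = (231, {1}, ∅).
AvoidsPAt : ℕ → List ℕ → Set
AvoidsPAt x []      = ⊤
AvoidsPAt x (y ∷ l) = x < y → All (x <_) l

AvoidsP : List ℕ → Set
AvoidsP = AllTails AvoidsPAt

data Before (y z : ℕ) : List ℕ → Set where
  here  : ∀ {l} → z ∈ l → Before y z (y ∷ l)
  there : ∀ {w l} → Before y z l → Before y z (w ∷ l)

-- x followed by l: x is not the first entry of an occurrence of r = (132, ∅, {2}).
AvoidsRAt : ℕ → List ℕ → Set
AvoidsRAt x l = ∀ z → Before (suc z) z l → ¬ x < z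

AvoidsR : List ℕ → Set
AvoidsR = AllTails AvoidsRAt

AvoidsPR : List ℕ → Set
AvoidsPR l = AvoidsP l × AvoidsR l

-- Inserting a new maximum at position i creates no occurrence of p iff the entry just
-- before position i is smaller than everything after it.
PSafe : List ℕ → ℕ → Set
PSafe l       zero          = ⊤
PSafe []      (suc j)       = ⊤
PSafe (x ∷ l) (suc zero)    = All (x <_) l
PSafe (x ∷ l) (suc (suc j)) = PSafe l (suc j)

-- Inserting m at position i creates no occurrence of r iff, when m - 1 comes after
-- position i, no entry before position i is smaller than m - 1.
RSafe : ℕ → List ℕ → ℕ → Set
RSafe m l       zero    = ⊤
RSafe m []      (suc i) = ⊤
RSafe m (x ∷ l) (suc i) = (pred m ∈ drop i l → ¬ x < pred m) × RSafe m l i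

AvoidsP-insertAt⁺ : ∀ {m} i l → All (_< m) l → i ≤ length l →
                    AvoidsP l → PSafe l i → AvoidsP (insertAt i m l)
AvoidsP-insertAt⁺ zero          []          _             _         av        _ = tt , tt
AvoidsP-insertAt⁺ zero          (y ∷ l)     (y<m ∷ _)     _         av        _ =
  (λ m<y → ⊥-elim (<-asym m<y y<m)) , av
AvoidsP-insertAt⁺ (suc zero)    (x ∷ l)     bounded       _         (_ , av)  safe =
  (λ _ → safe) , AvoidsP-insertAt⁺ zero l (All.tail bounded) z≤n av tt
AvoidsP-insertAt⁺ {m} (suc (suc i)) (x ∷ y ∷ l) (x<m ∷ bounded) (s≤s i≤n) (avx , av) safe =
  (λ x<y → All-insertAt⁺ i m l x<m (avx x<y)) , AvoidsP-insertAt⁺ (suc i) (y ∷ l) bounded i≤n av safe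

AvoidsP-insertAt⁻ : ∀ {m} i l → All (_< m) l → i ≤ length l →
                    AvoidsP (insertAt i m l) → AvoidsP l × PSafe l i
AvoidsP-insertAt⁻ zero          l           _           _         (_ , av)       = av , tt
AvoidsP-insertAt⁻ (suc zero)    (x ∷ l)     (x<m ∷ _)   _         (avx , _ , av) = (avx′ l (avx x<m) , av) , avx x<m
  where
  avx′ : ∀ l → All (x <_) l → AvoidsPAt x l
  avx′ []      _        = tt
  avx′ (y ∷ l) (_ ∷ x<) = λ _ → x<
AvoidsP-insertAt⁻ {m} (suc (suc i)) (x ∷ y ∷ l) (x<m ∷ bounded) (s≤s i≤n) (avx , av)
  with AvoidsP-insertAt⁻ (suc i) (y ∷ l) bounded i≤n av
... | av′ , safe = ((λ x<y → All-insertAt⁻ i m l (avx x<y)) , av′) , safe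

Before⇒∈ˡ : ∀ {y z l} → Before y z l → y ∈ l
Before⇒∈ˡ (here _)  = here refl
Before⇒∈ˡ (there p) = there (Before⇒∈ˡ p)

Before⇒∈ʳ : ∀ {y z l} → Before y z l → z ∈ l
Before⇒∈ʳ (here p)  = there p
Before⇒∈ʳ (there p) = there (Before⇒∈ʳ p)

Before-insertAt⁻ : ∀ {y z} i m l → Before y z (insertAt i m l) →
                   Before y z l ⊎ (y ≡ m × z ∈ drop i l) ⊎ z ≡ m
Before-insertAt⁻ zero    m l       (here p)  = inj₂ (inj₁ (refl , p))
Before-insertAt⁻ zero    m l       (there p) = inj₁ p
Before-insertAt⁻ (suc i) m []      (here ())
Before-insertAt⁻ (suc i) m []      (there ())
Before-insertAt⁻ (suc i) m (x ∷ l) (here p) with ∈-insertAt⁻ i m l p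
... | inj₁ z≡m  = inj₂ (inj₂ z≡m)
... | inj₂ z∈l  = inj₁ (here z∈l)
Before-insertAt⁻ (suc i) m (x ∷ l) (there p) = Sum.map₁ there (Before-insertAt⁻ i m l p)

Before-insertAt⁺ : ∀ {y z} i m l → Before y z l → Before y z (insertAt i m l)
Before-insertAt⁺ zero    m l       p         = there p
Before-insertAt⁺ (suc i) m (x ∷ l) (here p)  = here (∈-insertAt⁺ i m l p)
Before-insertAt⁺ (suc i) m (x ∷ l) (there p) = there (Before-insertAt⁺ i m l p)

Before-insertAt-self : ∀ {z} i m l → z ∈ drop i l → Before m z (insertAt i m l)
Before-insertAt-self zero    m l       p = here p
Before-insertAt-self (suc i) m (x ∷ l) p = there (Before-insertAt-self i m l p)

∈-drop⁻ : ∀ {x : ℕ} i l → x ∈ drop i l → x ∈ l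
∈-drop⁻ i l p = subst (_ ∈_) (take++drop≡id i l) (∈-++⁺ʳ (take i l) p)

-- The new maximum m can only play the 3 of an occurrence of r, and then m - 1 plays the 2.
AvoidsRAt-insertAt⁺ : ∀ {x m} i l → All (_< m) l → AvoidsRAt x l → (pred m ∈ drop i l → ¬ x < pred m) →
                      AvoidsRAt x (insertAt i m l)
AvoidsRAt-insertAt⁺ {x} {m} i l bounded av safe z p with Before-insertAt⁻ i m l p
... | inj₁ q                = av z q
... | inj₂ (inj₁ (1+z≡m , q)) =
  subst (λ w → ¬ x < w) (sym (cong pred 1+z≡m)) (safe (subst (_∈ drop i l) (cong pred 1+z≡m) q))
... | inj₂ (inj₂ refl) with ∈-insertAt⁻ i z l (Before⇒∈ˡ p)
...   | inj₁ 1+z≡z  = ⊥-elim (<-irrefl (sym 1+z≡z) (n<1+n z))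
...   | inj₂ 1+z∈l  = ⊥-elim (<-asym (All.lookup bounded 1+z∈l) (n<1+n z))

AvoidsRAt-insertAt⁻ : ∀ {x m} i l → All (_< m) l → AvoidsRAt x (insertAt i m l) →
                      AvoidsRAt x l × (pred m ∈ drop i l → ¬ x < pred m)
AvoidsRAt-insertAt⁻ {x} {m@(suc m′)} i l bounded av = (λ z → av z ∘ Before-insertAt⁺ i m l) , safe
  where
  safe : m′ ∈ drop i l → ¬ x < m′
  safe p = av m′ (Before-insertAt-self i m l p)
AvoidsRAt-insertAt⁻ {m = zero} i l bounded av = (λ z → av z ∘ Before-insertAt⁺ i 0 l) , safe
  where
  safe : 0 ∈ drop i l → _
  safe p = ⊥-elim (n≮0 (All.lookup bounded (∈-drop⁻ i l p)))

AvoidsR-insertAt⁺ : ∀ {m} i l → All (_< m) l → AvoidsR l → RSafe m l i → AvoidsR (insertAt i m l)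
AvoidsR-insertAt⁺ zero    l       bounded av _ =
  (λ z p m<z → <-asym m<z (All.lookup bounded (Before⇒∈ʳ p))) , av
AvoidsR-insertAt⁺ (suc i) []      bounded av _ = (λ z ()) , tt
AvoidsR-insertAt⁺ (suc i) (x ∷ l) (_ ∷ bounded) (avx , av) (safex , safe) =
  AvoidsRAt-insertAt⁺ i l bounded avx safex , AvoidsR-insertAt⁺ i l bounded av safe

AvoidsR-insertAt⁻ : ∀ {m} i l → All (_< m) l → AvoidsR (insertAt i m l) → AvoidsR l × RSafe m l i
AvoidsR-insertAt⁻ zero    l       bounded (_ , av) = av , tt
AvoidsR-insertAt⁻ (suc i) []      bounded _        = tt , tt
AvoidsR-insertAt⁻ (suc i) (x ∷ l) (_ ∷ bounded) (avx , av)
  with AvoidsRAt-insertAt⁻ i l bounded avx | AvoidsR-insertAt⁻ i l bounded av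
... | avx′ , safex | av′ , safe = (avx′ , av′) , (safex , safe)

isActive : ℕ → List ℕ → ℕ → Bool
isActive m σ = activeSite (rlMinima σ) (indexOf (pred m) σ)

PSafe⇔nthBit : ∀ l j → j < length l → PSafe l (suc j) ⇔ T (nthBit (rlMinima l) j)
PSafe⇔nthBit (x ∷ l)     zero    _         with all? (x <?_) l
... | yes x<l = mk⇔ (λ _ → tt) (λ _ → x<l)
... | no  x≮l = mk⇔ x≮l λ ()
PSafe⇔nthBit (x ∷ y ∷ l) (suc j) (s<s j<n) = PSafe⇔nthBit (y ∷ l) j j<n

RSafe⇔ : ∀ m l i → RSafe m l i ⇔ (pred m ∈ drop i l → All (λ x → ¬ x < pred m) (take i l))
RSafe⇔ m l i = mk⇔ (to l i) (from l i)
  where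
  to : ∀ l i → RSafe m l i → pred m ∈ drop i l → All (λ x → ¬ x < pred m) (take i l)
  to l       zero    _              _ = []
  to []      (suc i) _              ()
  to (x ∷ l) (suc i) (safex , safe) p = safex p ∷ to l i safe p
  from : ∀ l i → (pred m ∈ drop i l → All (λ x → ¬ x < pred m) (take i l)) → RSafe m l i
  from l       zero    _ = tt
  from []      (suc i) _ = tt
  from (x ∷ l) (suc i) f = All.head ∘ f , from l i (All.tail ∘ f)

Unique⇒take-drop-disjoint : ∀ {x : ℕ} k l → Unique l → x ∈ take k l → x ∈ drop k l → ⊥
Unique⇒take-drop-disjoint (suc k) (y ∷ l) (y∉l ∷ _) (here refl) q = All.lookup y∉l (∈-drop⁻ k l q) refl
Unique⇒take-drop-disjoint (suc k) (y ∷ l) (_ ∷ u)   (there p)   q = Unique⇒take-drop-disjoint k l u p q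

isActive⇒safe : ∀ {m σ} i → IsPermutation m σ → i ≤ m → T (isActive m σ i) → PSafe σ i × RSafe m σ i
isActive⇒safe zero _ _ _ = tt , tt
isActive⇒safe {suc m} {σ} (suc j) (isPermutation len u _ complete) j<1+m active
  with Equivalence.to T-∧ active
... | before , rlmin =
  Equivalence.from (PSafe⇔nthBit σ j (subst (j <_) (sym len) j<1+m)) rlmin ,
  Equivalence.from (RSafe⇔ (suc m) σ (suc j))
    (λ m∈drop → ⊥-elim (Unique⇒take-drop-disjoint (suc j) σ u m∈take m∈drop))
  where
  m∈take : m ∈ take (suc j) σ
  m∈take = Equivalence.to (indexOf<⇔∈take m σ (suc j) (complete m ≤-refl)) (<ᵇ⇒< _ _ before)

-- The first entry of l is m or smaller than m, so RSafe forbids m after position k.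
RSafe⇒∈take : ∀ {m} k l → Unique l → All (_< suc m) l → m ∈ l →
              RSafe (suc m) l (suc k) → m ∈ take (suc k) l
RSafe⇒∈take {m} k l@(x ∷ _) u (x<1+m ∷ _) m∈l rsafe
  with ∈-++⁻ (take (suc k) l) (subst (m ∈_) (sym (take++drop≡id (suc k) l)) m∈l)
... | inj₁ m∈take = m∈take
... | inj₂ m∈drop
  with Equivalence.to (RSafe⇔ (suc m) l (suc k)) rsafe m∈drop | m≤n⇒m<n∨m≡n (s≤s⁻¹ x<1+m)
...   | x≮m ∷ _ | inj₁ x<m  = ⊥-elim (x≮m x<m)
...   | _       | inj₂ refl = ⊥-elim (Unique⇒take-drop-disjoint (suc k) l u (here refl) m∈drop)

safe⇒isActive : ∀ {m σ} i → IsPermutation m σ → i ≤ m → PSafe σ i → RSafe m σ i → T (isActive m σ i)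
safe⇒isActive zero _ _ _ _ = tt
safe⇒isActive {suc m} {σ} (suc j) (isPermutation len u bounded complete) j<1+m psafe rsafe =
  Equivalence.from T-∧
    (<⇒<ᵇ (Equivalence.from (indexOf<⇔∈take m σ (suc j) m∈σ) (RSafe⇒∈take j σ u bounded m∈σ rsafe)) ,
     Equivalence.to (PSafe⇔nthBit σ j (subst (j <_) (sym len) j<1+m)) psafe)
  where
  m∈σ = complete m ≤-refl

AvoidsPR-insertAt⁺ : ∀ {m σ} i → IsPermutation m σ → i ≤ m → AvoidsPR σ → T (isActive m σ i) →
                     AvoidsPR (insertAt i m σ)
AvoidsPR-insertAt⁺ {m} {σ} i perm@(isPermutation len _ bounded _) i≤m (avP , avR) active
  with isActive⇒safe i perm i≤m active
... | psafe , rsafe = AvoidsP-insertAt⁺ i σ bounded (subst (i ≤_) (sym len) i≤m) avP psafe ,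
                      AvoidsR-insertAt⁺ i σ bounded avR rsafe

AvoidsPR-insertAt⁻ : ∀ {m σ} i → IsPermutation m σ → i ≤ m → AvoidsPR (insertAt i m σ) →
                     AvoidsPR σ × T (isActive m σ i)
AvoidsPR-insertAt⁻ {m} {σ} i perm@(isPermutation len _ bounded _) i≤m (avP , avR)
  with AvoidsP-insertAt⁻ i σ bounded (subst (i ≤_) (sym len) i≤m) avP | AvoidsR-insertAt⁻ i σ bounded avR
... | avP′ , psafe | avR′ , rsafe = (avP′ , avR′) , safe⇒isActive i perm i≤m psafe rsafe

children : ℕ → List ℕ → List (List ℕ)
children m σ = map (λ i → insertAt i m σ) (filterᵇ (isActive m σ) (upTo (suc m)))

avoiders : ℕ → List (List ℕ)
avoiders zero    = [] ∷ []
avoiders (suc m) = concatMap (children m) (avoiders m)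

∈-children⁻ : ∀ m σ π → π ∈ children m σ →
              Σ ℕ λ i → i ≤ m × T (isActive m σ i) × π ≡ insertAt i m σ
∈-children⁻ m σ π π∈
  with ∈-map∘filter⁻ (λ i → insertAt i m σ) (λ i → T? (isActive m σ i)) {xs = upTo (suc m)} π∈
... | i , i∈ , π≡ , active = i , s≤s⁻¹ (∈-upTo⁻ i∈) , active , π≡

avoiders-sound : ∀ m π → π ∈ avoiders m → IsPermutation m π × AvoidsPR π
avoiders-sound zero    .[] (here refl) = isPermutation refl [] [] (λ _ ()) , (tt , tt)
avoiders-sound (suc m) π   π∈ with find (∈-concatMap⁻ (children m) {xs = avoiders m} π∈)
... | σ , σ∈ , π∈children with ∈-children⁻ m σ π π∈children | avoiders-sound m σ σ∈
...   | i , i≤m , active , refl | perm , av = IsPermutation-insertAt i perm , AvoidsPR-insertAt⁺ i perm i≤m av active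

avoiders-complete : ∀ m π → IsPermutation m π → AvoidsPR π → π ∈ avoiders m
avoiders-complete zero    []  _    _  = here refl
avoiders-complete (suc m) π   perm av with IsPermutation-remove perm
... | π≡ , perm′ , i≤m with AvoidsPR-insertAt⁻ (indexOf m π) perm′ i≤m (subst AvoidsPR (sym π≡) av)
...   | av′ , active = ∈-concatMap⁺ (children m) {xs = avoiders m} (lose σ∈ π∈children)
  where
  σ = remove m π
  σ∈ : σ ∈ avoiders m
  σ∈ = avoiders-complete m σ perm′ av′
  π∈children : π ∈ children m σ
  π∈children = subst (_∈ children m σ) π≡
    (∈-map∘filter⁺ (λ i → insertAt i m σ) (λ i → T? (isActive m σ i))
                   (indexOf m π , ∈-upTo⁺ (s≤s i≤m) , refl , active))

AllPairs-mono-∈ : {A : Set} {R S : A → A → Set} (xs : List A) → AllPairs R xs →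
                  (∀ {x y} → x ∈ xs → y ∈ xs → R x y → S x y) → AllPairs S xs
AllPairs-mono-∈ []       []         f = []
AllPairs-mono-∈ (x ∷ xs) (Rx ∷ Rxs) f =
  All.tabulate (λ y∈ → f (here refl) (there y∈) (All.lookup Rx y∈)) ∷
  AllPairs-mono-∈ xs Rxs (λ x∈ y∈ → f (there x∈) (there y∈))

unique-map⁺-∈ : {A B : Set} (f : A → B) (xs : List A) → Unique xs →
                (∀ {x y} → x ∈ xs → y ∈ xs → f x ≡ f y → x ≡ y) → Unique (map f xs)
unique-map⁺-∈ f xs u inj = AllPairs.map⁺ (AllPairs-mono-∈ xs u (λ x∈ y∈ x≢y → x≢y ∘ inj x∈ y∈))

remove-children : ∀ m σ π → All (_< m) σ → π ∈ children m σ → remove m π ≡ σ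
remove-children m σ π bounded π∈ with ∈-children⁻ m σ π π∈
... | i , _ , _ , refl = remove-insertAt i m σ (bounded⇒∉ bounded)

children-unique : ∀ m σ → IsPermutation m σ → Unique (children m σ)
children-unique m σ (isPermutation len _ bounded _) =
  unique-map⁺-∈ (λ i → insertAt i m σ) sites
    (Unique.filter⁺ (λ i → T? (isActive m σ i)) (Unique.upTo⁺ (suc m))) inj
  where
  sites = filterᵇ (isActive m σ) (upTo (suc m))
  ≤length : ∀ {i} → i ∈ sites → i ≤ length σ
  ≤length i∈ = subst (_ ≤_) (sym len)
    (s≤s⁻¹ (∈-upTo⁻ (proj₁ (∈-filter⁻ (λ i → T? (isActive m σ i)) {xs = upTo (suc m)} i∈))))
  inj : ∀ {i j} → i ∈ sites → j ∈ sites → insertAt i m σ ≡ insertAt j m σ → i ≡ j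
  inj {i} {j} i∈ j∈ e = begin
    i                              ≡⟨ indexOf-insertAt i m σ (bounded⇒∉ bounded) (≤length i∈) ⟨
    indexOf m (insertAt i m σ)     ≡⟨ cong (indexOf m) e ⟩
    indexOf m (insertAt j m σ)     ≡⟨ indexOf-insertAt j m σ (bounded⇒∉ bounded) (≤length j∈) ⟩
    j                              ∎
    where open ≡-Reasoning

avoiders-unique : ∀ m → Unique (avoiders m)
avoiders-unique zero    = [] ∷ []
avoiders-unique (suc m) = Unique.concat⁺
  (All.map⁺ (All.tabulate (λ {σ} σ∈ → children-unique m σ (proj₁ (avoiders-sound m σ σ∈)))))
  (AllPairs.map⁺ (AllPairs-mono-∈ (avoiders m) (avoiders-unique m) disjoint))
  where
  bounded : ∀ {σ} → σ ∈ avoiders m → All (_< m) σ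
  bounded σ∈ = IsPermutation.bounded (proj₁ (avoiders-sound m _ σ∈))
  disjoint : ∀ {σ τ} → σ ∈ avoiders m → τ ∈ avoiders m → σ ≢ τ →
             Disjoint (children m σ) (children m τ)
  disjoint {σ} {τ} σ∈ τ∈ σ≢τ (π∈σ , π∈τ) =
    σ≢τ (trans (sym (remove-children m σ _ (bounded σ∈) π∈σ)) (remove-children m τ _ (bounded τ∈) π∈τ))

-- The number of descendants of σ len levels further down the generating tree.
permWeight : ℕ → List ℕ → ℕ
permWeight len π = weight len (rlMinima π) (indexOf (pred (length π)) π)

permWeight-insertAt : ∀ len m σ i → IsPermutation (suc m) σ → i ≤ suc m →
                      permWeight len (insertAt i (suc m) σ) ≡ childWeight len (rlMinima σ) i
permWeight-insertAt len m σ i (isPermutation len≡ _ bounded _) i≤ = begin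
  weight len (rlMinima π) (indexOf (pred (length π)) π)
    ≡⟨ cong (λ n → weight len (rlMinima π) (indexOf (pred n) π))
            (trans (length-insertAt i (suc m) σ) (cong suc len≡)) ⟩
  weight len (rlMinima π) (indexOf (suc m) π)
    ≡⟨ cong (weight len (rlMinima π))
            (indexOf-insertAt i (suc m) σ (bounded⇒∉ bounded) (subst (i ≤_) (sym len≡) i≤)) ⟩
  weight len (rlMinima π) i
    ≡⟨ cong (λ bs → weight len bs i) (rlMinima-insertAt i (suc m) σ bounded) ⟩
  childWeight len (rlMinima σ) i ∎
  where
  open ≡-Reasoning
  π = insertAt i (suc m) σ

∑-children : ∀ len m σ → IsPermutation (suc m) σ →
             ∑ (children (suc m) σ) (permWeight len) ≡ permWeight (suc len) σ
∑-children len m σ perm@(isPermutation len≡ _ _ complete) = begin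
  ∑ (children (suc m) σ) (permWeight len)
    ≡⟨ ∑-map sites (λ i → insertAt i (suc m) σ) (permWeight len) ⟩
  ∑ sites (λ i → permWeight len (insertAt i (suc m) σ))
    ≡⟨ ∑-filter (λ i → T? (isActive (suc m) σ i)) (upTo (2 + m)) _ ⟩
  ∑ (upTo (2 + m)) (λ i → if isActive (suc m) σ i then permWeight len (insertAt i (suc m) σ) else 0)
    ≡⟨ ∑-upTo (2 + m) (λ i → if isActive (suc m) σ i then permWeight len (insertAt i (suc m) σ) else 0) ⟩
  ∑< (2 + m) (λ i → if isActive (suc m) σ i then permWeight len (insertAt i (suc m) σ) else 0)
    ≡⟨ ∑<-cong-< (2 + m) (λ i i< →
         cong (if isActive (suc m) σ i then_else 0) (permWeight-insertAt len m σ i perm (s≤s⁻¹ i<))) ⟩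
  ∑< (2 + m) (λ i → if isActive (suc m) σ i then childWeight len (rlMinima σ) i else 0)
    ≡⟨ cong (λ n → ∑< (suc n) (λ i → if isActive (suc m) σ i then childWeight len (rlMinima σ) i else 0))
            (trans (length-rlMinima σ) len≡) ⟨
  ∑< (suc (length (rlMinima σ))) (λ i → if isActive (suc m) σ i then childWeight len (rlMinima σ) i else 0)
    ≡⟨ ∑-childWeight len (rlMinima σ) (indexOf m σ) (endsInTrue σ len≡)
         (subst (indexOf m σ <_) (sym (length-rlMinima σ)) (indexOf<length m σ (complete m ≤-refl))) ⟩
  weight (suc len) (rlMinima σ) (indexOf m σ)
    ≡⟨ cong (λ n → weight (suc len) (rlMinima σ) (indexOf (pred n) σ)) len≡ ⟨
  permWeight (suc len) σ ∎
  where
  open ≡-Reasoning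
  sites = filterᵇ (isActive (suc m) σ) (upTo (2 + m))
  endsInTrue : ∀ l → length l ≡ suc m → EndsInTrue (rlMinima l)
  endsInTrue (x ∷ l) _ = EndsInTrue-rlMinima x l

∑-avoiders : ∀ m len → ∑ (avoiders (suc m)) (permWeight len) ≡ descendants (len + m) 0 0
∑-avoiders zero    len = trans (+-identityʳ _) (cong (λ n → descendants n 0 0) (sym (+-identityʳ len)))
∑-avoiders (suc m) len = begin
  ∑ (avoiders (2 + m)) (permWeight len)
    ≡⟨ ∑-concatMap (children (suc m)) (avoiders (suc m)) (permWeight len) ⟩
  ∑ (avoiders (suc m)) (λ σ → ∑ (children (suc m) σ) (permWeight len))
    ≡⟨ ∑-cong-∈ (avoiders (suc m)) (λ σ σ∈ →
         ∑-children len m σ (proj₁ (avoiders-sound (suc m) σ σ∈))) ⟩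
  ∑ (avoiders (suc m)) (permWeight (suc len))
    ≡⟨ ∑-avoiders m (suc len) ⟩
  descendants (suc len + m) 0 0
    ≡⟨ cong (λ n → descendants n 0 0) (+-suc len m) ⟨
  descendants (len + suc m) 0 0 ∎
  where open ≡-Reasoning

length-avoiders : ∀ n → length (avoiders n) ≡ rhsCoeff n
length-avoiders zero    = sym rhsCoeff-zero
length-avoiders (suc m) = begin
  length (avoiders (suc m))          ≡⟨ length≡∑1 (avoiders (suc m)) ⟩
  ∑ (avoiders (suc m)) (λ _ → 1)     ≡⟨ ∑-avoiders m 0 ⟩
  descendants m 0 0                  ≡⟨ descendants≡closedForm m 0 0 ⟩
  closedForm m 0 0                   ≡⟨ rhsCoeff-suc m ⟨
  rhsCoeff (suc m)                   ∎
  where open ≡-Reasoning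

-- Out-of-range positions read as 0; every use below carries a bound.
nth : List ℕ → ℕ → ℕ
nth []      _       = 0
nth (x ∷ l) zero    = x
nth (x ∷ l) (suc k) = nth l k

-- Occurrences of p and r by positions: p at a, a + 1, c; r at a, b, c with l[b] = l[c] + 1.
POccurrence : List ℕ → Set
POccurrence l = Σ ℕ λ a → Σ ℕ λ c →
  (suc a < c) × (c < length l) × (nth l c < nth l a) × (nth l a < nth l (suc a))

ROccurrence : List ℕ → Set
ROccurrence l = Σ ℕ λ a → Σ ℕ λ b → Σ ℕ λ c →
  (a < b) × (b < c) × (c < length l) × (nth l a < nth l c) × (nth l b ≡ suc (nth l c))

All-nth : ∀ {P : ℕ → Set} l k → All P l → k < length l → P (nth l k)
All-nth (x ∷ l) zero    (px ∷ _) _         = px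
All-nth (x ∷ l) (suc k) (_ ∷ ps) (s<s k<n) = All-nth l k ps k<n

∈⇒nth : ∀ {z} l → z ∈ l → Σ ℕ λ k → (k < length l) × (nth l k ≡ z)
∈⇒nth (x ∷ l) (here z≡x) = 0 , z<s , sym z≡x
∈⇒nth (x ∷ l) (there p) with ∈⇒nth l p
... | k , k<n , e = suc k , s<s k<n , e

nth-∈ : ∀ l k → k < length l → nth l k ∈ l
nth-∈ (x ∷ l) zero    _         = here refl
nth-∈ (x ∷ l) (suc k) (s<s k<n) = there (nth-∈ l k k<n)

nth-Before : ∀ l b c → b < c → c < length l → Before (nth l b) (nth l c) l
nth-Before (x ∷ l) zero    (suc c) _         (s<s c<n) = here (nth-∈ l c c<n)
nth-Before (x ∷ l) (suc b) (suc c) (s<s b<c) (s<s c<n) = there (nth-Before l b c b<c c<n)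

Before⇒nth : ∀ {y z} l → Before y z l →
             Σ ℕ λ b → Σ ℕ λ c → (b < c) × (c < length l) × (nth l b ≡ y) × (nth l c ≡ z)
Before⇒nth (x ∷ l) (here p) with ∈⇒nth l p
... | k , k<n , e = 0 , suc k , z<s , s<s k<n , refl , e
Before⇒nth (x ∷ l) (there p) with Before⇒nth l p
... | b , c , b<c , c<n , e₁ , e₂ = suc b , suc c , s<s b<c , s<s c<n , e₁ , e₂

AvoidsP⇒¬POccurrence : ∀ l → AvoidsP l → ¬ POccurrence l
AvoidsP⇒¬POccurrence (x ∷ y ∷ l) (avx , _) (zero , suc (suc c) , _ , s<s (s<s c<n) , l[c]<x , x<y) =
  <-asym l[c]<x (All-nth l c (avx x<y) c<n)
AvoidsP⇒¬POccurrence (x ∷ y ∷ l) _ (zero , suc zero , s<s () , _)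
AvoidsP⇒¬POccurrence (x ∷ l) (_ , av) (suc a , suc c , s<s a+1<c , s<s c<n , p , q) =
  AvoidsP⇒¬POccurrence l av (a , c , a+1<c , c<n , p , q)

¬POccurrence⇒AvoidsP : ∀ l → Unique l → ¬ POccurrence l → AvoidsP l
¬POccurrence⇒AvoidsP []      _          _    = tt
¬POccurrence⇒AvoidsP (x ∷ l) (x∉l ∷ u) ¬occ =
  avoidsAt l x∉l (¬occ ∘ start) , ¬POccurrence⇒AvoidsP l u (¬occ ∘ extend)
  where
  extend : POccurrence l → POccurrence (x ∷ l)
  extend (a , c , a+1<c , c<n , p , q) = suc a , suc c , s<s a+1<c , s<s c<n , p , q
  StartsAtHead : List ℕ → Set
  StartsAtHead l = Σ ℕ λ k → (suc (suc k) < suc (length l)) × (nth l (suc k) < x) × (x < nth l 0)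
  start : StartsAtHead l → POccurrence (x ∷ l)
  start (k , k<n , p , q) = 0 , suc (suc k) , s<s z<s , k<n , p , q
  avoidsAt : ∀ l → All (x ≢_) l → ¬ StartsAtHead l → AvoidsPAt x l
  avoidsAt []      _              _     = tt
  avoidsAt (y ∷ l) (_ ∷ x∉l) ¬start x<y = All.tabulate x<
    where
    x< : ∀ {z} → z ∈ l → x < z
    x< {z} z∈l with ∈⇒nth l z∈l | <-cmp x z
    ... | _ , _ , _       | tri< x<z _ _ = x<z
    ... | _ , _ , _       | tri≈ _ x≡z _ = ⊥-elim (All.lookup x∉l z∈l x≡z)
    ... | k , k<n , l[k]≡z | tri> _ _ z<x =
      ⊥-elim (¬start (k , s<s (s<s k<n) , subst (_< x) (sym l[k]≡z) z<x , x<y))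

AvoidsR⇒¬ROccurrence : ∀ l → AvoidsR l → ¬ ROccurrence l
AvoidsR⇒¬ROccurrence (x ∷ l) (avx , _) (zero , suc b , suc c , _ , s<s b<c , s<s c<n , p , q) =
  avx (nth l c) (subst (λ w → Before w (nth l c) l) q (nth-Before l b c b<c c<n)) p
AvoidsR⇒¬ROccurrence (x ∷ l) (_ , av) (suc a , suc b , suc c , s<s a<b , s<s b<c , s<s c<n , p , q) =
  AvoidsR⇒¬ROccurrence l av (a , b , c , a<b , b<c , c<n , p , q)

¬ROccurrence⇒AvoidsR : ∀ l → ¬ ROccurrence l → AvoidsR l
¬ROccurrence⇒AvoidsR []      _    = tt
¬ROccurrence⇒AvoidsR (x ∷ l) ¬occ = avoidsAt , ¬ROccurrence⇒AvoidsR l (¬occ ∘ extend)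
  where
  extend : ROccurrence l → ROccurrence (x ∷ l)
  extend (a , b , c , a<b , b<c , c<n , p , q) = suc a , suc b , suc c , s<s a<b , s<s b<c , s<s c<n , p , q
  avoidsAt : AvoidsRAt x l
  avoidsAt z before x<z with Before⇒nth l before
  ... | b , c , b<c , c<n , e₁ , e₂ =
    ¬occ (0 , suc b , suc c , z<s , s<s b<c , s<s c<n , subst (x <_) (sym e₂) x<z , trans e₁ (cong suc (sym e₂)))

toℕList : ∀ {k j} → Vec (Fin k) j → List ℕ
toℕList []       = []
toℕList (x ∷ xs) = toℕ x ∷ toℕList xs

length-toℕList : ∀ {k j} (v : Vec (Fin k) j) → length (toℕList v) ≡ j
length-toℕList []       = refl
length-toℕList (x ∷ xs) = cong suc (length-toℕList xs)

nth-toℕList : ∀ {k j} (v : Vec (Fin k) j) (i : Fin j) → nth (toℕList v) (toℕ i) ≡ toℕ (lookup v i)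
nth-toℕList (x ∷ xs) fzero    = refl
nth-toℕList (x ∷ xs) (fsuc i) = nth-toℕList xs i

nth-toℕList-fromℕ< : ∀ {n j} (v : Vec (Fin n) j) k (k<j : k < j) →
                     nth (toℕList v) k ≡ toℕ (lookup v (fromℕ< k<j))
nth-toℕList-fromℕ< v k k<j =
  trans (cong (nth (toℕList v)) (sym (Fin.toℕ-fromℕ< k<j))) (nth-toℕList v (fromℕ< k<j))

nth-injective : ∀ l a b → Unique l → a < length l → b < length l → nth l a ≡ nth l b → a ≡ b
nth-injective (x ∷ l) zero    zero    _         _         _         _ = refl
nth-injective (x ∷ l) zero    (suc b) (x∉l ∷ _) _         (s<s b<n) e = ⊥-elim (All.lookup x∉l (nth-∈ l b b<n) e)
nth-injective (x ∷ l) (suc a) zero    (x∉l ∷ _) (s<s a<n) _         e = ⊥-elim (All.lookup x∉l (nth-∈ l a a<n) (sym e))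
nth-injective (x ∷ l) (suc a) (suc b) (_ ∷ u)   (s<s a<n) (s<s b<n) e = cong suc (nth-injective l a b u a<n b<n e)

nth-ext : ∀ l₁ l₂ → length l₁ ≡ length l₂ →
          (∀ k → k < length l₁ → nth l₁ k ≡ nth l₂ k) → l₁ ≡ l₂
nth-ext []       []       _   _ = refl
nth-ext (x ∷ l₁) (y ∷ l₂) len e =
  cong₂ _∷_ (e 0 z<s) (nth-ext l₁ l₂ (suc-injective len) (λ k → e (suc k) ∘ s<s))

unique-toℕList : ∀ {k j} (v : Vec (Fin k) j) →
                 (∀ a b → lookup v a ≡ lookup v b → a ≡ b) → Unique (toℕList v)
unique-toℕList []       _   = []
unique-toℕList (x ∷ xs) inj =
  All.tabulate x∉xs ∷ unique-toℕList xs (λ a b → Fin.suc-injective ∘ inj (fsuc a) (fsuc b))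
  where
  x∉xs : ∀ {z} → z ∈ toℕList xs → toℕ x ≢ z
  x∉xs z∈ x≡z with ∈⇒nth (toℕList xs) z∈
  ... | k , k<n , e with subst (k <_) (length-toℕList xs) k<n
  ...   | k<j
    with inj fzero (fsuc (fromℕ< k<j)) (Fin.toℕ-injective (trans x≡z (trans (sym e) (nth-toℕList-fromℕ< xs k k<j))))
  ...     | ()

injective⇒surjective : ∀ {n} (f : Fin n → Fin n) → (∀ i j → f i ≡ f j → i ≡ j) →
                       ∀ y → Σ (Fin n) λ i → f i ≡ y
injective⇒surjective {suc n} f inj y with Fin.any? (λ i → f i Fin.≟ y)
... | yes found = found
... | no  ¬found = ⊥-elim (<-irrefl refl (Fin.injective⇒≤ {f = g} g-injective))
  where
  y≢f : ∀ i → y ≢ f i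
  y≢f i e = ¬found (i , sym e)
  g : Fin (suc n) → Fin n
  g i = punchOut (y≢f i)
  g-injective : ∀ {i j} → g i ≡ g j → i ≡ j
  g-injective {i} {j} e = inj i j (Fin.punchOut-injective (y≢f i) (y≢f j) e)

IsPerm⇒IsPermutation : ∀ {n} (v : Vec (Fin n) n) → IsPerm v → IsPermutation n (toℕList v)
IsPerm⇒IsPermutation {n} v perm = isPermutation (length-toℕList v) (unique-toℕList v perm) (bounded v) complete
  where
  bounded : ∀ {j} (w : Vec (Fin n) j) → All (_< n) (toℕList w)
  bounded []      = []
  bounded (x ∷ w) = Fin.toℕ<n x ∷ bounded w
  complete : ∀ x → x < n → x ∈ toℕList v
  complete x x<n with injective⇒surjective (lookup v) perm (fromℕ< x<n)
  ... | i , v[i]≡x = subst (_∈ toℕList v) v[i]≡x′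
        (nth-∈ (toℕList v) (toℕ i) (subst (toℕ i <_) (sym (length-toℕList v)) (Fin.toℕ<n i)))
    where
    v[i]≡x′ : nth (toℕList v) (toℕ i) ≡ x
    v[i]≡x′ = trans (nth-toℕList v i) (trans (cong toℕ v[i]≡x) (Fin.toℕ-fromℕ< x<n))

IsPermutation⇒IsPerm : ∀ {n} (v : Vec (Fin n) n) → IsPermutation n (toℕList v) → IsPerm v
IsPermutation⇒IsPerm {n} v (isPermutation len u _ _) i j v[i]≡v[j] = Fin.toℕ-injective
  (nth-injective (toℕList v) (toℕ i) (toℕ j) u (bound i) (bound j)
    (trans (nth-toℕList v i) (trans (cong toℕ v[i]≡v[j]) (sym (nth-toℕList v j)))))
  where
  bound : ∀ i → toℕ i < length (toℕList v)
  bound i = subst (toℕ i <_) (sym len) (Fin.toℕ<n i)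

-- Out of range, x is replaced by the default d, which only serves to witness that Fin n is inhabited.
fromℕ-or : ∀ {n} → ℕ → Fin n → Fin n
fromℕ-or {n} x d with x <? n
... | yes x<n = fromℕ< x<n
... | no  _   = d

toℕ-fromℕ-or : ∀ {n} x (d : Fin n) → x < n → toℕ (fromℕ-or x d) ≡ x
toℕ-fromℕ-or {n} x d x<n with x <? n
... | yes x<n′ = Fin.toℕ-fromℕ< x<n′
... | no  x≮n  = ⊥-elim (x≮n x<n)

fromℕList : (n : ℕ) → List ℕ → Vec (Fin n) n
fromℕList n l = tabulate (λ i → fromℕ-or (nth l (toℕ i)) i)

toℕList-fromℕList : ∀ n l → IsPermutation n l → toℕList (fromℕList n l) ≡ l
toℕList-fromℕList n l (isPermutation len _ bounded _) =
  nth-ext (toℕList (fromℕList n l)) l (trans (length-toℕList (fromℕList n l)) (sym len)) same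
  where
  same : ∀ k → k < length (toℕList (fromℕList n l)) → nth (toℕList (fromℕList n l)) k ≡ nth l k
  same k k<n′ = begin
    nth (toℕList (fromℕList n l)) k          ≡⟨ nth-toℕList-fromℕ< (fromℕList n l) k k<n ⟩
    toℕ (lookup (fromℕList n l) i)           ≡⟨ cong toℕ (Vec.lookup∘tabulate _ i) ⟩
    toℕ (fromℕ-or (nth l (toℕ i)) i)
      ≡⟨ cong (λ k → toℕ (fromℕ-or (nth l k) i)) (Fin.toℕ-fromℕ< k<n) ⟩
    toℕ (fromℕ-or (nth l k) i)
      ≡⟨ toℕ-fromℕ-or (nth l k) i (All-nth l k bounded (subst (k <_) (sym len) k<n)) ⟩
    nth l k                                  ∎
    where
    open ≡-Reasoning
    k<n : k < n
    k<n = subst (k <_) (length-toℕList (fromℕList n l)) k<n′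
    i = fromℕ< k<n

fromℕList-toℕList : ∀ {n} (v : Vec (Fin n) n) → fromℕList n (toℕList v) ≡ v
fromℕList-toℕList {n} v = trans (Vec.tabulate-cong same) (Vec.tabulate∘lookup v)
  where
  same : ∀ i → fromℕ-or (nth (toℕList v) (toℕ i)) i ≡ lookup v i
  same i = Fin.toℕ-injective
    (trans (toℕ-fromℕ-or _ i (subst (_< n) (sym (nth-toℕList v i)) (Fin.toℕ<n (lookup v i)))) (nth-toℕList v i))

monotone⇒orderIsomorphic : (σ : Fin 3 → Fin 3) → (∀ a b → σ a ≡ σ b → a ≡ b) → {v : Fin 3 → ℕ} →
  (∀ a b → σ a <ᶠ σ b → v a < v b) → ∀ a b → (v a < v b) ⇔ (σ a <ᶠ σ b)
monotone⇒orderIsomorphic σ inj {v} mono a b = mk⇔ reflect (mono a b)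
  where
  reflect : v a < v b → σ a <ᶠ σ b
  reflect va<vb with Fin.<-cmp (σ a) (σ b)
  ... | tri< σa<σb _ _ = σa<σb
  ... | tri≈ _ σa≡σb _ = ⊥-elim (<-irrefl (cong v (inj a b σa≡σb)) va<vb)
  ... | tri> _ _ σb<σa = ⊥-elim (<-asym va<vb (mono b a σb<σa))

orderIsomorphic-231 : {v : Fin 3 → ℕ} → v 0F < v 1F → v 2F < v 0F →
                      ∀ a b → (v a < v b) ⇔ (σ231 a <ᶠ σ231 b)
orderIsomorphic-231 {v} v0<v1 v2<v0 = monotone⇒orderIsomorphic σ231 σ231-inj mono
  where
  mono : ∀ a b → σ231 a <ᶠ σ231 b → v a < v b
  mono 0F 1F _ = v0<v1
  mono 2F 0F _ = v2<v0
  mono 2F 1F _ = <-trans v2<v0 v0<v1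
  mono 0F 0F (s<s ())
  mono 1F 0F (s<s ())
  mono 1F 1F (s<s (s<s ()))
  mono _  2F ()

orderIsomorphic-132 : {v : Fin 3 → ℕ} → v 0F < v 2F → v 2F < v 1F →
                      ∀ a b → (v a < v b) ⇔ (σ132 a <ᶠ σ132 b)
orderIsomorphic-132 {v} v0<v2 v2<v1 = monotone⇒orderIsomorphic σ132 σ132-inj mono
  where
  mono : ∀ a b → σ132 a <ᶠ σ132 b → v a < v b
  mono 0F 1F _ = <-trans v0<v2 v2<v1
  mono 0F 2F _ = v0<v2
  mono 2F 1F _ = v2<v1
  mono 1F 1F (s<s (s<s ()))
  mono 1F 2F (s<s ())
  mono 2F 2F (s<s ())

module _ {n : ℕ} (π : Vec (Fin n) n) where

  private
    at : ∀ k → k < n → ℕ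
    at k k<n = toℕ (lookup π (fromℕ< k<n))

    at≡nth : ∀ k (k<n : k < n) → at k k<n ≡ nth (toℕList π) k
    at≡nth k k<n = sym (nth-toℕList-fromℕ< π k k<n)

    <n : ∀ {k} → k < length (toℕList π) → k < n
    <n {k} = subst (k <_) (length-toℕList π)

  Contains-patP⇒POccurrence : Contains π patP → POccurrence (toℕList π)
  Contains-patP⇒POccurrence (i₁ , i₂ , i₃ , _ , i₂<i₃ , iso , adjacent , _) =
    toℕ i₁ , toℕ i₃ , subst (_< toℕ i₃) i₂≡1+i₁ i₂<i₃ ,
    subst (toℕ i₃ <_) (sym (length-toℕList π)) (Fin.toℕ<n i₃) ,
    subst₂ _<_ (sym (nth-toℕList π i₃)) (sym (nth-toℕList π i₁)) (Equivalence.from (iso 2F 0F) z<s) ,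
    subst₂ _<_ (sym (nth-toℕList π i₁)) (trans (sym (nth-toℕList π i₂)) (cong (nth (toℕList π)) i₂≡1+i₁))
              (Equivalence.from (iso 0F 1F) (s<s z<s))
    where
    i₂≡1+i₁ : toℕ i₂ ≡ suc (toℕ i₁)
    i₂≡1+i₁ = adjacent 0F refl

  POccurrence⇒Contains-patP : POccurrence (toℕList π) → Contains π patP
  POccurrence⇒Contains-patP (a , c , a+1<c , c<len , l[c]<l[a] , l[a]<l[a+1]) =
    fromℕ< a<n , fromℕ< a+1<n , fromℕ< c<n ,
    subst₂ _<_ (sym (Fin.toℕ-fromℕ< a<n)) (sym (Fin.toℕ-fromℕ< a+1<n)) ≤-refl ,
    subst₂ _<_ (sym (Fin.toℕ-fromℕ< a+1<n)) (sym (Fin.toℕ-fromℕ< c<n)) a+1<c ,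
    orderIsomorphic-231 (subst₂ _<_ (sym (at≡nth a a<n)) (sym (at≡nth (suc a) a+1<n)) l[a]<l[a+1])
                        (subst₂ _<_ (sym (at≡nth c c<n)) (sym (at≡nth a a<n)) l[c]<l[a]) ,
    (λ { 0F refl → trans (Fin.toℕ-fromℕ< a+1<n) (cong suc (sym (Fin.toℕ-fromℕ< a<n))) ; 1F () }) ,
    (λ _ ())
    where
    c<n = <n c<len
    a+1<n = <-trans a+1<c c<n
    a<n = <-trans (n<1+n a) a+1<n

  Contains-patR⇒ROccurrence : Contains π patR → ROccurrence (toℕList π)
  Contains-patR⇒ROccurrence (i₁ , i₂ , i₃ , i₁<i₂ , i₂<i₃ , iso , _ , adjacent) =
    toℕ i₁ , toℕ i₂ , toℕ i₃ , i₁<i₂ , i₂<i₃ ,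
    subst (toℕ i₃ <_) (sym (length-toℕList π)) (Fin.toℕ<n i₃) ,
    subst₂ _<_ (sym (nth-toℕList π i₁)) (sym (nth-toℕList π i₃)) (Equivalence.from (iso 0F 2F) z<s) ,
    trans (nth-toℕList π i₂) (trans (adjacent 1F refl 2F 1F refl refl) (cong suc (sym (nth-toℕList π i₃))))

  ROccurrence⇒Contains-patR : ROccurrence (toℕList π) → Contains π patR
  ROccurrence⇒Contains-patR (a , b , c , a<b , b<c , c<len , l[a]<l[c] , l[b]≡1+l[c]) =
    fromℕ< a<n , fromℕ< b<n , fromℕ< c<n ,
    subst₂ _<_ (sym (Fin.toℕ-fromℕ< a<n)) (sym (Fin.toℕ-fromℕ< b<n)) a<b ,
    subst₂ _<_ (sym (Fin.toℕ-fromℕ< b<n)) (sym (Fin.toℕ-fromℕ< c<n)) b<c ,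
    orderIsomorphic-132 (subst₂ _<_ (sym (at≡nth a a<n)) (sym (at≡nth c c<n)) l[a]<l[c])
                        (subst₂ _<_ (sym (at≡nth c c<n)) (sym (at≡nth b b<n)) (subst (_ <_) (sym l[b]≡1+l[c]) ≤-refl)) ,
    (λ _ ()) ,
    (λ { 0F () ; 1F refl 2F 1F refl refl → trans (at≡nth b b<n) (trans l[b]≡1+l[c] (cong suc (sym (at≡nth c c<n))))
       ; 1F refl 0F _ () _ ; 1F refl 1F _ () _ ; 1F refl 2F 0F _ () ; 1F refl 2F 2F _ () })
    where
    c<n = <n c<len
    b<n = <-trans b<c c<n
    a<n = <-trans a<b b<n

  Avoids-patP⇔AvoidsP : Unique (toℕList π) → Avoids π patP ⇔ AvoidsP (toℕList π)
  Avoids-patP⇔AvoidsP u = mk⇔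
    (λ avoids → ¬POccurrence⇒AvoidsP (toℕList π) u (avoids ∘ POccurrence⇒Contains-patP))
    (λ av → AvoidsP⇒¬POccurrence (toℕList π) av ∘ Contains-patP⇒POccurrence)

  Avoids-patR⇔AvoidsR : Avoids π patR ⇔ AvoidsR (toℕList π)
  Avoids-patR⇔AvoidsR = mk⇔
    (λ avoids → ¬ROccurrence⇒AvoidsR (toℕList π) (avoids ∘ ROccurrence⇒Contains-patR))
    (λ av → AvoidsR⇒¬ROccurrence (toℕList π) av ∘ Contains-patR⇒ROccurrence)

avoidingPerms : (n : ℕ) → List (Vec (Fin n) n)
avoidingPerms n = map (fromℕList n) (avoiders n)

avoidingPerms-unique : ∀ n → Unique (avoidingPerms n)
avoidingPerms-unique n = unique-map⁺-∈ (fromℕList n) (avoiders n) (avoiders-unique n) inj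
  where
  inj : ∀ {l l′} → l ∈ avoiders n → l′ ∈ avoiders n → fromℕList n l ≡ fromℕList n l′ → l ≡ l′
  inj {l} {l′} l∈ l′∈ e = begin
    l                            ≡⟨ toℕList-fromℕList n l (proj₁ (avoiders-sound n l l∈)) ⟨
    toℕList (fromℕList n l)      ≡⟨ cong toℕList e ⟩
    toℕList (fromℕList n l′)     ≡⟨ toℕList-fromℕList n l′ (proj₁ (avoiders-sound n l′ l′∈)) ⟩
    l′                           ∎
    where open ≡-Reasoning

∈-avoidingPerms⇔ : ∀ {n} (π : Vec (Fin n) n) →
                   π ∈ avoidingPerms n ⇔ (IsPerm π × Avoids π patP × Avoids π patR)
∈-avoidingPerms⇔ {n} π = mk⇔ to from
  where
  to : π ∈ avoidingPerms n → IsPerm π × Avoids π patP × Avoids π patR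
  to π∈ with ∈-map⁻ (fromℕList n) π∈
  ... | l , l∈ , refl with avoiders-sound n l l∈
  ...   | perm , avP , avR =
    IsPermutation⇒IsPerm π (subst (IsPermutation n) (sym π≡) perm) ,
    Equivalence.from (Avoids-patP⇔AvoidsP π u) (subst AvoidsP (sym π≡) avP) ,
    Equivalence.from (Avoids-patR⇔AvoidsR π) (subst AvoidsR (sym π≡) avR)
    where
    π≡ : toℕList π ≡ l
    π≡ = toℕList-fromℕList n l perm
    u : Unique (toℕList π)
    u = subst Unique (sym π≡) (IsPermutation.unique perm)
  from : IsPerm π × Avoids π patP × Avoids π patR → π ∈ avoidingPerms n
  from (isPerm , avoidsP , avoidsR) = subst (_∈ avoidingPerms n) (fromℕList-toℕList π)
    (∈-map⁺ (fromℕList n) (avoiders-complete n (toℕList π) perm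
      (Equivalence.to (Avoids-patP⇔AvoidsP π (IsPermutation.unique perm)) avoidsP ,
       Equivalence.to (Avoids-patR⇔AvoidsR π) avoidsR)))
    where
    perm = IsPerm⇒IsPermutation π isPerm

proposition20 : (n : ℕ) → AvCard₂ n patP patR (rhsCoeff n)
proposition20 n = avoidingPerms n , avoidingPerms-unique n , ∈-avoidingPerms⇔ ,
                  trans (length-map (fromℕList n) (avoiders n)) (length-avoiders n)
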